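{- There exists $C>0$ such that the following holds. Let $k,D,m\geq 2$ be integers and let $$\mathcal{F}:=\{\mathrm{Span}(f_1,\ldots,f_m)\ :\ f_t\in\mathbb{Z}^k,\ |f_t|_1<3D \text{ for } t\in[m]\}.$$ Then $|\mathcal{F}|\leq k^{C\cdot kD\log D}$.
   Context: $|f|_1=\sum_i|x_i|$ is the $L_1$-norm of $f=(x_1,\ldots,x_k)\in\mathbb{Z}^k$; $\mathrm{Span}(f_1,\ldots,f_m)$ is the subgroup of $\mathbb{Z}^k$ of integer linear combinations of $f_1,\ldots,f_m$; $\log$ is the binary logarithm. -}

module Defs where

open import Data.Nat using (ℕ; zero; suc; _<_; _*_)
import Data.Nat as ℕ
open import Data.Integer as ℤ using (ℤ; ∣_∣)
open import Data.Fin using (Fin; zero; suc)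
open import Data.Product using (Σ; _×_)
open import Relation.Binary.PropositionalEquality using (_≡_)

ℤ^ : ℕ → Set
ℤ^ k = Fin k → ℤ

sumℕ : ∀ {n} → (Fin n → ℕ) → ℕ
sumℕ {zero}  f = 0
sumℕ {suc n} f = f zero ℕ.+ sumℕ (λ i → f (suc i))

sumℤ : ∀ {n} → (Fin n → ℤ) → ℤ
sumℤ {zero}  f = ℤ.0ℤ
sumℤ {suc n} f = f zero ℤ.+ sumℤ (λ i → f (suc i))

norm1 : ∀ {k} → ℤ^ k → ℕ
norm1 f = sumℕ (λ i → ∣ f i ∣)

Gens : ℕ → ℕ → Set
Gens k m = Fin m → ℤ^ k

_∈Span_ : ∀ {k m} → ℤ^ k → Gens k m → Set
_∈Span_ {k} {m} v fs = Σ (Fin m → ℤ) λ c → ∀ i → v i ≡ sumℤ (λ t → c t ℤ.* fs t i)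

SameSpan : ∀ {k m} → Gens k m → Gens k m → Set
SameSpan fs gs = ∀ v → ((v ∈Span fs → v ∈Span gs) × (v ∈Span gs → v ∈Span fs))

Bounded : ∀ {k m} → ℕ → Gens k m → Set
Bounded D fs = ∀ t → norm1 (fs t) < 3 * D

-- A greedy pass over f₁, …, f_m keeps a sublist g₁, …, g_r spanning the same lattice in which no gᵢ
-- lies in the span of the later ones (membership in the span of a list of integer vectors is decidable
-- by integer Gaussian elimination). Such a chain of vectors of norm ≤ n is short: weight v ∈ ℤ^k by
-- (a/b)^|v|₁ with a = 2n - 1, b = 2n, and let Φ(S) be the total weight of the points of Span S of norm
-- ≤ |S| n. Passing from S to g ∷ S with g ∉ Span S adds the translates v + g of the old points, which
-- are new, so Φ grows by a factor 1 + (a/b)^n ≥ 3/2 at each step, while the total weight of ℤ^k is at most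
-- ((b + a)/(b - a))^k = (4n - 1)^k. Hence (3/2)^r ≤ (4n)^k and r = O(k log D). Finally each gᵢ, having
-- norm < 3D, is a sum of 3D - 1 vectors from {0, ±e₁, …, ±e_k}, so the lattice is spanned by one of
-- at most (2k + 1)^((3D - 1) r) ≤ k^(C k D log D) families, padded with zeros to length m.

module Submission where

open import Defs
open import Data.Nat as ℕ using (ℕ; zero; suc; _+_; _*_; _^_; _∸_; _≤_; _<_; _⊓_; z≤n; s≤s)
import Data.Nat.Properties as ℕP
import Data.Nat.Tactic.RingSolver as ℕRing
import Data.Nat.GCD as ℕGCD
open import Data.Nat.Logarithm using (⌊log₂_⌋; ⌊log₂⌋-mono-≤; ⌊log₂[2^n]⌋≡n)
open import Data.Integer as ℤ using (ℤ; +_; -[1+_]; 0ℤ; 1ℤ; -1ℤ; ∣_∣)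
import Data.Integer.Properties as ℤP
import Data.Integer.Tactic.RingSolver as ℤRing
open import Data.Integer.Divisibility.Signed using (_∣_; divides; _∣?_; quotient)
import Data.Integer.Divisibility.Signed as ℤ∣
open import Data.Fin using (Fin; zero; suc)
open import Data.Vec.Functional using (head; tail) renaming (_∷_ to _∷ᵛ_)
import Data.Vec.Functional.Relation.Binary.Pointwise as Vector
open import Data.List using (List; []; _∷_; map; length; tabulate; cartesianProductWith; _++_; replicate)
import Data.List.Properties as ListP
open import Data.List.Membership.Propositional using (_∈_; lose)
open import Data.List.Membership.Propositional.Properties
  using (∈-map⁺; ∈-map⁻; ∈-tabulate⁺; ∈-tabulate⁻; ∈-cartesianProductWith⁺; ∈-cartesianProductWith⁻; ∈-++⁻; ∈-++⁺ˡ)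
open import Data.List.Relation.Unary.Any using (Any; here; there)
open import Data.List.Relation.Unary.All as All using (All)
import Data.List.Relation.Unary.All.Properties as AllP
open import Data.List.Relation.Binary.Pointwise using (Pointwise; []; _∷_; All-resp-Pointwise)
import Data.List.Relation.Binary.Pointwise.Properties as PointwiseP
open import Data.List.Relation.Binary.Sublist.Propositional using (_⊆_; []; _∷_; _∷ʳ_)
open import Data.List.Relation.Binary.Sublist.Propositional.Properties using (length-mono-≤; Any-resp-⊆)
open import Data.Product using (Σ; ∃; ∃₂; _×_; _,_; proj₁; proj₂)
open import Data.Sum using (_⊎_; inj₁; inj₂)
open import Data.Empty using (⊥-elim)
open import Function using (_⇔_; mk⇔)
open import Function.Properties.Equivalence using () renaming (sym to ⇔-sym)
open import Relation.Binary.Core using (_Preserves_⟶_)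
open import Relation.Binary.PropositionalEquality
open import Relation.Nullary using (Dec; yes; no; ¬_; contradiction)
open import Relation.Nullary.Decidable as Dec using (_×-dec_)

infix  4 _≈_ _⊑_
infixl 6 _+v_ _-v_
infixl 7 _·v_

_≈_ : ∀ {k} → ℤ^ k → ℤ^ k → Set
_≈_ = Vector.Pointwise _≡_

0v : ∀ {k} → ℤ^ k
0v _ = 0ℤ

_+v_ : ∀ {k} → ℤ^ k → ℤ^ k → ℤ^ k
(u +v w) i = u i ℤ.+ w i

-v_ : ∀ {k} → ℤ^ k → ℤ^ k
(-v u) i = ℤ.- u i

_-v_ : ∀ {k} → ℤ^ k → ℤ^ k → ℤ^ k
(u -v w) i = u i ℤ.- w i

_·v_ : ∀ {k} → ℤ → ℤ^ k → ℤ^ k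
(c ·v u) i = c ℤ.* u i

≈0∷ᵛtail : ∀ {k} {v : ℤ^ (suc k)} → head v ≡ 0ℤ → v ≈ 0ℤ ∷ᵛ tail v
≈0∷ᵛtail h zero    = h
≈0∷ᵛtail h (suc i) = refl

∷ᵛ-cong : ∀ {k} {j} {u u′ : ℤ^ k} → u ≈ u′ → j ∷ᵛ u ≈ j ∷ᵛ u′
∷ᵛ-cong e zero    = refl
∷ᵛ-cong e (suc i) = e i

norm1-resp : ∀ {k} {u v : ℤ^ k} → u ≈ v → norm1 u ≡ norm1 v
norm1-resp {zero}  e = refl
norm1-resp {suc k} e = cong₂ _+_ (cong ∣_∣ (e zero)) (norm1-resp {k} (λ i → e (suc i)))

∣coord∣≤norm1 : ∀ {k} (v : ℤ^ k) i → ∣ v i ∣ ≤ norm1 v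
∣coord∣≤norm1 v zero    = ℕP.m≤m+n _ _
∣coord∣≤norm1 v (suc i) = ℕP.≤-trans (∣coord∣≤norm1 (tail v) i) (ℕP.m≤n+m _ _)

norm1-+ : ∀ {k} (u w : ℤ^ k) → norm1 (u +v w) ≤ norm1 u + norm1 w
norm1-+ {zero}  u w = z≤n
norm1-+ {suc k} u w = begin
  ∣ u zero ℤ.+ w zero ∣ + norm1 (tail u +v tail w)
    ≤⟨ ℕP.+-mono-≤ (ℤP.∣i+j∣≤∣i∣+∣j∣ (u zero) (w zero)) (norm1-+ (tail u) (tail w)) ⟩
  ∣ u zero ∣ + ∣ w zero ∣ + (norm1 (tail u) + norm1 (tail w)) ≡⟨ interchange ∣ u zero ∣ ∣ w zero ∣ _ _ ⟩
  ∣ u zero ∣ + norm1 (tail u) + (∣ w zero ∣ + norm1 (tail w)) ∎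
  where
  open ℕP.≤-Reasoning
  interchange : ∀ a b c d → a + b + (c + d) ≡ a + c + (b + d)
  interchange = ℕRing.solve-∀

norm1-0v : ∀ {k} → norm1 (0v {k}) ≡ 0
norm1-0v {zero}  = refl
norm1-0v {suc k} = norm1-0v {k}

-- Spans of finite lists of vectors

-- Vectors are functions, so membership has to be closed under ≈ explicitly.
data Span {k} (S : List (ℤ^ k)) : ℤ^ k → Set where
  0∈   : Span S 0v
  gen  : ∀ {g} → g ∈ S → Span S g
  +∈   : ∀ {u w} → Span S u → Span S w → Span S (u +v w)
  neg∈ : ∀ {u} → Span S u → Span S (-v u)
  ≈∈   : ∀ {u w} → u ≈ w → Span S u → Span S w

_⊑_ : ∀ {k} → List (ℤ^ k) → List (ℤ^ k) → Set
S ⊑ T = ∀ {v} → Span S v → Span T v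

module _ {k} {S : List (ℤ^ k)} where

  private
    ℕ·∈ : ∀ n {u} → Span S u → Span S (+ n ·v u)
    ℕ·∈ zero    p = ≈∈ (λ i → refl) 0∈
    ℕ·∈ (suc n) {u} p = ≈∈ (λ i → sym (ℤP.suc-* (+ n) (u i))) (+∈ p (ℕ·∈ n p))

  ·∈ : ∀ c {u} → Span S u → Span S (c ·v u)
  ·∈ (+ n)    p = ℕ·∈ n p
  ·∈ -[1+ n ] {u} p = ≈∈ (λ i → ℤP.neg-distribˡ-* (+ suc n) (u i)) (neg∈ (ℕ·∈ (suc n) p))

  -∈ : ∀ {u w} → Span S u → Span S w → Span S (u -v w)
  -∈ p q = +∈ p (neg∈ q)

Span-mono : ∀ {k} {S T : List (ℤ^ k)} → (∀ {g} → g ∈ S → Span T g) → S ⊑ T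
Span-mono S⊆T 0∈         = 0∈
Span-mono S⊆T (gen g∈S)  = S⊆T g∈S
Span-mono S⊆T (+∈ p q)   = +∈ (Span-mono S⊆T p) (Span-mono S⊆T q)
Span-mono S⊆T (neg∈ p)   = neg∈ (Span-mono S⊆T p)
Span-mono S⊆T (≈∈ e p)   = ≈∈ e (Span-mono S⊆T p)

Span-∷ : ∀ {k} {g : ℤ^ k} {S} → S ⊑ g ∷ S
Span-∷ = Span-mono (λ g∈S → gen (there g∈S))

Span-tail : ∀ {k} {S : List (ℤ^ (suc k))} {v} → Span S v → Span (map tail S) (tail v)
Span-tail 0∈        = 0∈
Span-tail (gen g∈S) = gen (∈-map⁺ tail g∈S)
Span-tail (+∈ p q)  = +∈ (Span-tail p) (Span-tail q)
Span-tail (neg∈ p)  = neg∈ (Span-tail p)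
Span-tail (≈∈ e p)  = ≈∈ (λ i → e (suc i)) (Span-tail p)

Span-0∷ᵛ : ∀ {k} {S : List (ℤ^ (suc k))} → (∀ {s} → s ∈ S → head s ≡ 0ℤ) →
           ∀ {w} → Span (map tail S) w → Span S (0ℤ ∷ᵛ w)
Span-0∷ᵛ h 0∈        = ≈∈ (λ { zero → refl ; (suc i) → refl }) 0∈
Span-0∷ᵛ h (gen w∈)  with ∈-map⁻ tail w∈
... | s , s∈S , refl = ≈∈ (≈0∷ᵛtail (h s∈S)) (gen s∈S)
Span-0∷ᵛ h (+∈ p q)  = ≈∈ (λ { zero → refl ; (suc i) → refl }) (+∈ (Span-0∷ᵛ h p) (Span-0∷ᵛ h q))
Span-0∷ᵛ h (neg∈ p)  = ≈∈ (λ { zero → refl ; (suc i) → refl }) (neg∈ (Span-0∷ᵛ h p))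
Span-0∷ᵛ h (≈∈ e p)  = ≈∈ (λ { zero → refl ; (suc i) → e i }) (Span-0∷ᵛ h p)

Span-head-∣ : ∀ {k} {S : List (ℤ^ (suc k))} {g} → (∀ {s} → s ∈ S → g ∣ head s) →
              ∀ {v} → Span S v → g ∣ head v
Span-head-∣ h 0∈        = divides 0ℤ refl
Span-head-∣ h (gen s∈S) = h s∈S
Span-head-∣ h (+∈ p q)  = ℤ∣.∣m∣n⇒∣m+n (Span-head-∣ h p) (Span-head-∣ h q)
Span-head-∣ h (neg∈ p)  = ℤ∣.∣m⇒∣-m (Span-head-∣ h p)
Span-head-∣ {g = g} h (≈∈ e p) = subst (g ∣_) (e zero) (Span-head-∣ h p)

sumℤ-cong : ∀ {n} {f g : Fin n → ℤ} → (∀ t → f t ≡ g t) → sumℤ f ≡ sumℤ g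
sumℤ-cong {zero}  e = refl
sumℤ-cong {suc n} e = cong₂ ℤ._+_ (e zero) (sumℤ-cong (λ t → e (suc t)))

sumℤ-+ : ∀ {n} (f g : Fin n → ℤ) → sumℤ (λ t → f t ℤ.+ g t) ≡ sumℤ f ℤ.+ sumℤ g
sumℤ-+ {zero}  f g = refl
sumℤ-+ {suc n} f g = trans (cong (ℤ._+_ (f zero ℤ.+ g zero)) (sumℤ-+ (λ t → f (suc t)) (λ t → g (suc t))))
                           (+-interchange (f zero) (g zero) _ _)
  where
  +-interchange : ∀ a b c d → a ℤ.+ b ℤ.+ (c ℤ.+ d) ≡ a ℤ.+ c ℤ.+ (b ℤ.+ d)
  +-interchange = ℤRing.solve-∀

sumℤ-*ˡ : ∀ {n} c (f : Fin n → ℤ) → sumℤ (λ t → c ℤ.* f t) ≡ c ℤ.* sumℤ f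
sumℤ-*ˡ {zero}  c f = sym (ℤP.*-zeroʳ c)
sumℤ-*ˡ {suc n} c f = trans (cong (ℤ._+_ (c ℤ.* f zero)) (sumℤ-*ˡ c (λ t → f (suc t))))
                            (sym (ℤP.*-distribˡ-+ c (f zero) _))

δ : ∀ {n} → Fin n → Fin n → ℤ
δ zero    zero    = 1ℤ
δ zero    (suc _) = 0ℤ
δ (suc _) zero    = 0ℤ
δ (suc s) (suc t) = δ s t

sumℤ-δ : ∀ {n} (s : Fin n) (f : Fin n → ℤ) → sumℤ (λ t → δ s t ℤ.* f t) ≡ f s
sumℤ-δ zero    f = trans (cong₂ ℤ._+_ (ℤP.*-identityˡ (f zero)) (sumℤ-*ˡ 0ℤ (λ t → f (suc t))))
                         (ℤP.+-identityʳ (f zero))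
sumℤ-δ (suc s) f = trans (ℤP.+-identityˡ _) (sumℤ-δ s (λ t → f (suc t)))

module _ {k m : ℕ} (fs : Gens k m) where

  ∈Span-≈ : ∀ {u v} → u ≈ v → u ∈Span fs → v ∈Span fs
  ∈Span-≈ e (c , u≡) = c , λ i → trans (sym (e i)) (u≡ i)

  ∈Span-0 : 0v ∈Span fs
  ∈Span-0 = (λ _ → 0ℤ) , λ i → sym (sumℤ-*ˡ 0ℤ (λ t → fs t i))

  ∈Span-gen : ∀ s → fs s ∈Span fs
  ∈Span-gen s = δ s , λ i → sym (sumℤ-δ s (λ t → fs t i))

  ∈Span-+ : ∀ {u w} → u ∈Span fs → w ∈Span fs → (u +v w) ∈Span fs
  ∈Span-+ (c , u≡) (d , w≡) = (λ t → c t ℤ.+ d t) , λ i → begin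
    _ ≡⟨ cong₂ ℤ._+_ (u≡ i) (w≡ i) ⟩
    sumℤ (λ t → c t ℤ.* fs t i) ℤ.+ sumℤ (λ t → d t ℤ.* fs t i)
      ≡⟨ sumℤ-+ (λ t → c t ℤ.* fs t i) (λ t → d t ℤ.* fs t i) ⟨
    sumℤ (λ t → c t ℤ.* fs t i ℤ.+ d t ℤ.* fs t i)
      ≡⟨ sumℤ-cong (λ t → ℤP.*-distribʳ-+ (fs t i) (c t) (d t)) ⟨
    sumℤ (λ t → (c t ℤ.+ d t) ℤ.* fs t i) ∎
    where open ≡-Reasoning

  ∈Span-· : ∀ a {u} → u ∈Span fs → (a ·v u) ∈Span fs
  ∈Span-· a (c , u≡) = (λ t → a ℤ.* c t) , λ i → begin
    a ℤ.* _                            ≡⟨ cong (a ℤ.*_) (u≡ i) ⟩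
    a ℤ.* sumℤ (λ t → c t ℤ.* fs t i)    ≡⟨ sumℤ-*ˡ a (λ t → c t ℤ.* fs t i) ⟨
    sumℤ (λ t → a ℤ.* (c t ℤ.* fs t i))  ≡⟨ sumℤ-cong (λ t → ℤP.*-assoc a (c t) (fs t i)) ⟨
    sumℤ (λ t → a ℤ.* c t ℤ.* fs t i)    ∎
    where open ≡-Reasoning

  Span⇒∈Span : ∀ {v} → Span (tabulate fs) v → v ∈Span fs
  Span⇒∈Span 0∈        = ∈Span-0
  Span⇒∈Span (gen g∈)  with ∈-tabulate⁻ g∈
  ... | s , refl = ∈Span-gen s
  Span⇒∈Span (+∈ p q)  = ∈Span-+ (Span⇒∈Span p) (Span⇒∈Span q)
  Span⇒∈Span (neg∈ p)  = ∈Span-≈ (λ i → ℤP.-1*i≡-i _) (∈Span-· -1ℤ (Span⇒∈Span p))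
  Span⇒∈Span (≈∈ e p)  = ∈Span-≈ e (Span⇒∈Span p)

∈Span⇒Span : ∀ {k} m (fs : Gens k m) {v} → v ∈Span fs → Span (tabulate fs) v
∈Span⇒Span zero    fs (c , v≡) = ≈∈ (λ i → sym (v≡ i)) 0∈
∈Span⇒Span (suc m) fs (c , v≡) =
  ≈∈ (λ i → sym (v≡ i))
     (+∈ (·∈ (c zero) (gen (here refl)))
         (Span-∷ (∈Span⇒Span m (λ t → fs (suc t)) ((λ t → c (suc t)) , λ i → refl))))

infix 4 _∼_
_∼_ : ∀ {k} → List (ℤ^ k) → List (ℤ^ k) → Set
S ∼ T = S ⊑ T × T ⊑ S

∼-trans : ∀ {k} {S T U : List (ℤ^ k)} → S ∼ T → T ∼ U → S ∼ U
∼-trans (S⊑T , T⊑S) (T⊑U , U⊑T) = (λ v∈ → T⊑U (S⊑T v∈)) , (λ v∈ → T⊑S (U⊑T v∈))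

∼-sym : ∀ {k} {S T : List (ℤ^ k)} → S ∼ T → T ∼ S
∼-sym (S⊑T , T⊑S) = T⊑S , S⊑T

Pointwise-sym : ∀ {k} {S T : List (ℤ^ k)} → Pointwise _≈_ S T → Pointwise _≈_ T S
Pointwise-sym = PointwiseP.symmetric (λ e i → sym (e i))

Pointwise⇒⊑ : ∀ {k} {S T : List (ℤ^ k)} → Pointwise _≈_ S T → S ⊑ T
Pointwise⇒⊑ S≈T = Span-mono (All.lookup (All-resp-Pointwise ≈∈ (Pointwise-sym S≈T) (All.tabulate gen)))

Pointwise⇒∼ : ∀ {k} {S T : List (ℤ^ k)} → Pointwise _≈_ S T → S ∼ T
Pointwise⇒∼ S≈T = Pointwise⇒⊑ S≈T , Pointwise⇒⊑ (Pointwise-sym S≈T)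

zeros-∼ : ∀ {k} {S T : List (ℤ^ k)} → (∀ {x} → x ∈ S → x ∈ T) → (∀ {y} → y ∈ T → y ∈ S ⊎ y ≡ 0v) →
          S ∼ T
zeros-∼ S⊆T T⊆S+0 = Span-mono (λ x∈ → gen (S⊆T x∈)) , Span-mono (λ y∈ → from-S-or-0 (T⊆S+0 y∈))
  where
  from-S-or-0 : ∀ {y} → _ ⊎ y ≡ 0v → Span _ y
  from-S-or-0 (inj₁ y∈) = gen y∈
  from-S-or-0 (inj₂ refl) = 0∈

tabulate-∼⇒SameSpan : ∀ {k m} (fs gs : Gens k m) → tabulate fs ∼ tabulate gs → SameSpan fs gs
tabulate-∼⇒SameSpan {m = m} fs gs (fs⊑gs , gs⊑fs) v =
  (λ v∈ → Span⇒∈Span gs (fs⊑gs (∈Span⇒Span m fs v∈))) ,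
  (λ v∈ → Span⇒∈Span fs (gs⊑fs (∈Span⇒Span m gs v∈)))

-- Deciding membership in a span

private
  ℕ-sum⇒ℤ-difference : ∀ d b c e f → d ℕ.+ b ℕ.* c ≡ e ℕ.* f → + d ≡ + e ℤ.* + f ℤ.- + b ℤ.* + c
  ℕ-sum⇒ℤ-difference d b c e f eq = begin
    + d                                ≡⟨ a≡a+b-b (+ d) (+ b ℤ.* + c) ⟩
    + d ℤ.+ + b ℤ.* + c ℤ.- + b ℤ.* + c ≡⟨ cong (λ z → + d ℤ.+ z ℤ.- + b ℤ.* + c) (ℤP.pos-* b c) ⟨
    + (d ℕ.+ b ℕ.* c) ℤ.- + b ℤ.* + c   ≡⟨ cong (λ z → + z ℤ.- + b ℤ.* + c) eq ⟩
    + (e ℕ.* f) ℤ.- + b ℤ.* + c         ≡⟨ cong (ℤ._- + b ℤ.* + c) (ℤP.pos-* e f) ⟩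
    + e ℤ.* + f ℤ.- + b ℤ.* + c         ∎
    where
    open ≡-Reasoning
    a≡a+b-b : ∀ a b → a ≡ a ℤ.+ b ℤ.- b
    a≡a+b-b = ℤRing.solve-∀

ℕ-bezout : ∀ m n → ∃₂ λ α β → + ℕGCD.gcd m n ≡ α ℤ.* + m ℤ.+ β ℤ.* + n
ℕ-bezout m n with ℕGCD.Bézout.identity (ℕGCD.gcd-GCD m n)
... | ℕGCD.Bézout.+- x y eq =
  + x , ℤ.- + y , trans (ℕ-sum⇒ℤ-difference _ y n x m eq)
                      (cong (ℤ._+_ (+ x ℤ.* + m)) (ℤP.neg-distribˡ-* (+ y) (+ n)))
... | ℕGCD.Bézout.-+ x y eq =
  ℤ.- + x , + y , trans (ℕ-sum⇒ℤ-difference _ x m y n eq)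
                      (trans (ℤP.+-comm (+ y ℤ.* + n) (ℤ.- (+ x ℤ.* + m)))
                             (cong (ℤ._+ (+ y ℤ.* + n)) (ℤP.neg-distribˡ-* (+ x) (+ m))))

record Bezout (x y : ℤ) : Set where
  field
    d α β : ℤ
    d≡    : d ≡ α ℤ.* x ℤ.+ β ℤ.* y
    d∣x   : d ∣ x
    d∣y   : d ∣ y

abs-multiple : ∀ z → ∃ λ σ → + ∣ z ∣ ≡ σ ℤ.* z
abs-multiple (+ n)    = 1ℤ , sym (ℤP.*-identityˡ (+ n))
abs-multiple -[1+ n ] = -1ℤ , sym (ℤP.-1*i≡-i -[1+ n ])

bezout : ∀ x y → Bezout x y
bezout x y with ℕ-bezout ∣ x ∣ ∣ y ∣ | abs-multiple x | abs-multiple y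
... | α , β , eq | σ , ∣x∣≡ | τ , ∣y∣≡ = record
  { d = + ℕGCD.gcd ∣ x ∣ ∣ y ∣
  ; α = α ℤ.* σ
  ; β = β ℤ.* τ
  ; d≡ = trans eq (cong₂ ℤ._+_ (trans (cong (α ℤ.*_) ∣x∣≡) (sym (ℤP.*-assoc α σ x)))
                             (trans (cong (β ℤ.*_) ∣y∣≡) (sym (ℤP.*-assoc β τ y))))
  ; d∣x = ℤ∣.∣ᵤ⇒∣ (ℕGCD.gcd[m,n]∣m ∣ x ∣ ∣ y ∣)
  ; d∣y = ℤ∣.∣ᵤ⇒∣ (ℕGCD.gcd[m,n]∣n ∣ x ∣ ∣ y ∣)
  }

record Pivot {k} (S : List (ℤ^ (suc k))) : Set where
  field
    p     : ℤ^ (suc k)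
    p∈    : Span S p
    p∣S   : ∀ {s} → s ∈ S → head p ∣ head s

pivot : ∀ {k} (S : List (ℤ^ (suc k))) → Pivot S
pivot []      = record { p = 0v ; p∈ = 0∈ ; p∣S = λ () }
pivot (s ∷ S) = record
  { p   = α ·v p +v β ·v s
  ; p∈  = +∈ (·∈ α (Span-∷ p∈)) (·∈ β (gen (here refl)))
  ; p∣S = λ { (here refl) → subst (_∣ head s) d≡ d∣y
            ; (there s∈S) → subst (_∣ _) d≡ (ℤ∣.∣-trans d∣x (p∣S s∈S)) }
  }
  where
  open Pivot (pivot S)
  open Bezout (bezout (head p) (head s))

-- The quotient x / g if g ∣ x, and the junk value 0 otherwise.
exactQuotient : ℤ → ℤ → ℤ
exactQuotient g x with g ∣? x
... | yes g∣x = quotient g∣x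
... | no  _   = 0ℤ

exactQuotient-correct : ∀ {g x} → g ∣ x → x ≡ exactQuotient g x ℤ.* g
exactQuotient-correct {g} {x} g∣x with g ∣? x
... | yes (divides q x≡) = x≡
... | no  g∤x            = ⊥-elim (g∤x g∣x)

-- Clearing the first coordinate of every generator with multiples of a pivot, whose first
-- coordinate divides all the others, reduces membership to one dimension less.
module Elimination {k} {S : List (ℤ^ (suc k))} (P : Pivot S) where

  open Pivot P

  reduce : ℤ^ (suc k) → ℤ^ (suc k)
  reduce s = s -v exactQuotient (head p) (head s) ·v p

  reduced : List (ℤ^ (suc k))
  reduced = map reduce S

  head-reduced≡0 : ∀ {r} → r ∈ reduced → head r ≡ 0ℤ
  head-reduced≡0 r∈R with ∈-map⁻ reduce r∈R
  ... | s , s∈S , refl = trans (cong (ℤ._-_ (head s)) (sym (exactQuotient-correct (p∣S s∈S))))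
                               (ℤP.+-inverseʳ (head s))

  reduced⊑S : reduced ⊑ S
  reduced⊑S = Span-mono λ r∈R → case-reduced (∈-map⁻ reduce r∈R)
    where
    case-reduced : ∀ {r} → ∃ (λ s → s ∈ S × r ≡ reduce s) → Span S r
    case-reduced (s , s∈S , refl) = -∈ (gen s∈S) (·∈ (exactQuotient (head p) (head s)) p∈)

  eliminate : ∀ {v} → Span S v → ∃ λ b → head v ≡ b ℤ.* head p × Span (map tail reduced) (tail (v -v b ·v p))
  eliminate 0∈ = 0ℤ , refl , ≈∈ (λ i → refl) 0∈
  eliminate (gen {s} s∈S) =
    exactQuotient (head p) (head s) , exactQuotient-correct (p∣S s∈S) , gen (∈-map⁺ tail (∈-map⁺ reduce s∈S))
  eliminate (+∈ {u} {w} x y) with eliminate x | eliminate y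
  ... | b , u≡ , x′ | c , w≡ , y′ =
    b ℤ.+ c , trans (cong₂ ℤ._+_ u≡ w≡) (sym (ℤP.*-distribʳ-+ (head p) b c)) ,
    ≈∈ (λ i → regroup (u (suc i)) (w (suc i)) b c (p (suc i))) (+∈ x′ y′)
    where
    regroup : ∀ a d b c x → (a ℤ.- b ℤ.* x) ℤ.+ (d ℤ.- c ℤ.* x) ≡ (a ℤ.+ d) ℤ.- (b ℤ.+ c) ℤ.* x
    regroup = ℤRing.solve-∀
  eliminate (neg∈ {u} x) with eliminate x
  ... | b , u≡ , x′ =
    ℤ.- b , trans (cong ℤ.-_ u≡) (ℤP.neg-distribˡ-* b (head p)) ,
    ≈∈ (λ i → regroup (u (suc i)) b (p (suc i))) (neg∈ x′)
    where
    regroup : ∀ a b x → ℤ.- (a ℤ.- b ℤ.* x) ≡ (ℤ.- a) ℤ.- (ℤ.- b) ℤ.* x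
    regroup = ℤRing.solve-∀
  eliminate (≈∈ e x) with eliminate x
  ... | b , u≡ , x′ = b , trans (sym (e zero)) u≡ , ≈∈ (λ i → cong (ℤ._- b ℤ.* p (suc i)) (e (suc i))) x′

  Span⇔pivot : head p ≢ 0ℤ → ∀ v → let q = exactQuotient (head p) (head v) in
    Span S v ⇔ (head p ∣ head v × Span (map tail reduced) (tail (v -v q ·v p)))
  Span⇔pivot g≢0 v = mk⇔ to from
    where
    q = exactQuotient (head p) (head v)
    instance _ = ℤ.≢-nonZero g≢0
    to : Span S v → head p ∣ head v × Span (map tail reduced) (tail (v -v q ·v p))
    to v∈ with eliminate v∈
    ... | b , v≡ , tail∈ with ℤP.*-cancelʳ-≡ q b (head p) (trans (sym (exactQuotient-correct g∣v)) v≡)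
      where g∣v = Span-head-∣ p∣S v∈
    ... | refl = Span-head-∣ p∣S v∈ , tail∈
    from : head p ∣ head v × Span (map tail reduced) (tail (v -v q ·v p)) → Span S v
    from (g∣v , tail∈) = ≈∈ rebuild (+∈ (reduced⊑S (Span-0∷ᵛ head-reduced≡0 tail∈)) (·∈ q p∈))
      where
      rebuild : (0ℤ ∷ᵛ tail (v -v q ·v p)) +v q ·v p ≈ v
      rebuild zero    = trans (ℤP.+-identityˡ _) (sym (exactQuotient-correct g∣v))
      rebuild (suc i) = a-b+b≡a (v (suc i)) (q ℤ.* p (suc i))
        where a-b+b≡a : ∀ a b → a ℤ.- b ℤ.+ b ≡ a
              a-b+b≡a = ℤRing.solve-∀

Span⇔heads-zero : ∀ {k} {S : List (ℤ^ (suc k))} → (∀ {s} → s ∈ S → head s ≡ 0ℤ) → ∀ v →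
                  Span S v ⇔ (head v ≡ 0ℤ × Span (map tail S) (tail v))
Span⇔heads-zero {S = S} h v = mk⇔ to from
  where
  to : Span S v → head v ≡ 0ℤ × Span (map tail S) (tail v)
  to v∈ = ℤ∣.0∣⇒≡0 (Span-head-∣ (λ s∈S → subst (0ℤ ∣_) (sym (h s∈S)) (divides 0ℤ refl)) v∈) ,
          Span-tail v∈
  from : head v ≡ 0ℤ × Span (map tail S) (tail v) → Span S v
  from (v≡ , tail∈) = ≈∈ (λ i → sym (≈0∷ᵛtail {v = v} v≡ i)) (Span-0∷ᵛ h tail∈)

Span? : ∀ {k} (S : List (ℤ^ k)) v → Dec (Span S v)
Span? {zero}  S v = yes (≈∈ (λ ()) 0∈)
Span? {suc k} S v with Pivot.p (pivot S) zero ℤ.≟ 0ℤ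
... | yes g≡0 = Dec.map (⇔-sym (Span⇔heads-zero heads≡0 v)) (head v ℤ.≟ 0ℤ ×-dec Span? (map tail S) (tail v))
  where
  heads≡0 : ∀ {s} → s ∈ S → head s ≡ 0ℤ
  heads≡0 s∈S = ℤ∣.0∣⇒≡0 (subst (_∣ _) g≡0 (Pivot.p∣S (pivot S) s∈S))
... | no g≢0 = Dec.map (⇔-sym (Span⇔pivot g≢0 v)) (head p ∣? head v ×-dec Span? (map tail reduced) (tail (v -v q ·v p)))
  where
  open Pivot (pivot S)
  open Elimination (pivot S)
  q = exactQuotient (head p) (head v)

-- Greedy extraction of a short chain

data ShortChain {k} (n : ℕ) : List (ℤ^ k) → Set where
  []   : ShortChain n []
  step : ∀ {g S} → ¬ Span S g → norm1 g ≤ n → ShortChain n S → ShortChain n (g ∷ S)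

record Greedy {k} (n : ℕ) (xs : List (ℤ^ k)) : Set where
  field
    basis    : List (ℤ^ k)
    chain    : ShortChain n basis
    basis⊆xs : basis ⊆ xs
    spans    : ∀ {x} → x ∈ xs → Span basis x

  basis∼xs : basis ∼ xs
  basis∼xs = Span-mono (λ s∈ → gen (Any-resp-⊆ basis⊆xs s∈)) , Span-mono spans

greedy : ∀ {k} n (xs : List (ℤ^ k)) → (∀ {x} → x ∈ xs → norm1 x ≤ n) → Greedy n xs
greedy n []       _ = record { basis = [] ; chain = [] ; basis⊆xs = [] ; spans = λ () }
greedy n (x ∷ xs) xs-short with greedy n xs (λ y∈ → xs-short (there y∈))
... | G with Span? (Greedy.basis G) x
...   | yes x∈ = record
  { basis    = basis
  ; chain    = chain
  ; basis⊆xs = x ∷ʳ basis⊆xs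
  ; spans    = λ { (here refl) → x∈ ; (there y∈) → spans y∈ }
  }
  where open Greedy G
...   | no x∉ = record
  { basis    = x ∷ basis
  ; chain    = step x∉ (xs-short (here refl)) chain
  ; basis⊆xs = refl ∷ basis⊆xs
  ; spans    = λ { (here refl) → gen (here refl) ; (there y∈) → Span-∷ (spans y∈) }
  }
  where open Greedy G

sumWindow : ℕ → (ℤ → ℕ) → ℕ
sumWindow zero    h = h 0ℤ
sumWindow (suc F) h = sumWindow F h + (h (+ suc F) + h -[1+ F ])

sumWindow-cong : ∀ F {h h′} → (∀ j → h j ≡ h′ j) → sumWindow F h ≡ sumWindow F h′
sumWindow-cong zero    e = e 0ℤ
sumWindow-cong (suc F) e = cong₂ _+_ (sumWindow-cong F e) (cong₂ _+_ (e _) (e _))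

sumWindow-mono : ∀ F {h h′} → (∀ j → h j ≤ h′ j) → sumWindow F h ≤ sumWindow F h′
sumWindow-mono zero    e = e 0ℤ
sumWindow-mono (suc F) e = ℕP.+-mono-≤ (sumWindow-mono F e) (ℕP.+-mono-≤ (e _) (e _))

sumWindow-+ : ∀ F h h′ → sumWindow F (λ j → h j + h′ j) ≡ sumWindow F h + sumWindow F h′
sumWindow-+ zero    h h′ = refl
sumWindow-+ (suc F) h h′ rewrite sumWindow-+ F h h′ =
  interchange (sumWindow F h) (sumWindow F h′) (h (+ suc F)) (h′ (+ suc F)) (h -[1+ F ]) (h′ -[1+ F ])
  where
  interchange : ∀ s s′ x x′ y y′ → s + s′ + ((x + x′) + (y + y′)) ≡ s + (x + y) + (s′ + (x′ + y′))
  interchange = ℕRing.solve-∀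

sumWindow-*ˡ : ∀ F c h → sumWindow F (λ j → c * h j) ≡ c * sumWindow F h
sumWindow-*ˡ zero    c h = refl
sumWindow-*ˡ (suc F) c h rewrite sumWindow-*ˡ F c h =
  trans (cong (_+_ (c * sumWindow F h)) (sym (ℕP.*-distribˡ-+ c _ _))) (sym (ℕP.*-distribˡ-+ c _ _))

centre≤sumWindow : ∀ F h → h 0ℤ ≤ sumWindow F h
centre≤sumWindow zero    h = ℕP.≤-refl
centre≤sumWindow (suc F) h = ℕP.≤-trans (centre≤sumWindow F h) (ℕP.m≤m+n _ _)

sumWindow-shift-down : ∀ F h → sumWindow F (λ j → h (j ℤ.- 1ℤ)) + h (+ F) ≡ sumWindow F h + h -[1+ F ]
sumWindow-shift-down zero    h = ℕP.+-comm (h -[1+ 0 ]) (h 0ℤ)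
sumWindow-shift-down (suc F) h = begin
  sumWindow F h′ + (h (+ F) + h′ -[1+ F ]) + h (+ suc F)
    ≡⟨ regroup (sumWindow F h′) (h (+ F)) _ _ ⟩
  sumWindow F h′ + h (+ F) + (h′ -[1+ F ] + h (+ suc F))
    ≡⟨ cong₂ _+_ (sumWindow-shift-down F h) (cong (λ n → h -[1+ suc n ] + h (+ suc F)) (ℕP.+-identityʳ F)) ⟩
  sumWindow F h + h -[1+ F ] + (h -[1+ suc F ] + h (+ suc F))
    ≡⟨ regroup′ (sumWindow F h) (h -[1+ F ]) _ _ ⟩
  sumWindow F h + (h (+ suc F) + h -[1+ F ]) + h -[1+ suc F ] ∎
  where
  open ≡-Reasoning
  h′ = λ j → h (j ℤ.- 1ℤ)
  regroup : ∀ s x y z → s + (x + y) + z ≡ s + x + (y + z)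
  regroup = ℕRing.solve-∀
  regroup′ : ∀ s x y z → s + x + (y + z) ≡ s + (z + x) + y
  regroup′ = ℕRing.solve-∀

sumWindow-shift-up : ∀ F h → sumWindow F (λ j → h (j ℤ.+ 1ℤ)) + h (ℤ.- + F) ≡ sumWindow F h + h (+ suc F)
sumWindow-shift-up zero    h = ℕP.+-comm (h (+ 1)) (h 0ℤ)
sumWindow-shift-up (suc F) h = begin
  sumWindow F h′ + (h′ (+ suc F) + h′ -[1+ F ]) + h -[1+ F ]
    ≡⟨ cong (λ z → sumWindow F h′ + (h′ (+ suc F) + h z) + h -[1+ F ]) (-[1+n]+1≡-n F) ⟩
  sumWindow F h′ + (h′ (+ suc F) + h (ℤ.- + F)) + h -[1+ F ]
    ≡⟨ regroup (sumWindow F h′) (h′ (+ suc F)) _ _ ⟩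
  sumWindow F h′ + h (ℤ.- + F) + (h′ (+ suc F) + h -[1+ F ])
    ≡⟨ cong₂ _+_ (sumWindow-shift-up F h) (cong (λ n → h (+ suc n) + h -[1+ F ]) (ℕP.+-comm F 1)) ⟩
  sumWindow F h + h (+ suc F) + (h (+ suc (suc F)) + h -[1+ F ])
    ≡⟨ regroup′ (sumWindow F h) (h (+ suc F)) _ _ ⟩
  sumWindow F h + (h (+ suc F) + h -[1+ F ]) + h (+ suc (suc F)) ∎
  where
  open ≡-Reasoning
  h′ = λ j → h (j ℤ.+ 1ℤ)
  -[1+n]+1≡-n : ∀ n → -[1+ n ] ℤ.+ 1ℤ ≡ ℤ.- + n
  -[1+n]+1≡-n zero    = refl
  -[1+n]+1≡-n (suc n) = refl
  regroup : ∀ s x y z → s + (x + y) + z ≡ s + y + (x + z)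
  regroup = ℕRing.solve-∀
  regroup′ : ∀ s x y z → s + x + (y + z) ≡ s + (x + z) + y
  regroup′ = ℕRing.solve-∀

SupportedIn₁ : ℕ → (ℤ → ℕ) → Set
SupportedIn₁ G h = ∀ j → G < ∣ j ∣ → h j ≡ 0

SupportedIn₁-translate : ∀ {G h} c → SupportedIn₁ G h → SupportedIn₁ (G + ∣ c ∣) (λ j → h (j ℤ.+ c))
SupportedIn₁-translate {G} c supp j G+∣c∣<∣j∣ = supp (j ℤ.+ c) (ℕP.+-cancelʳ-< ∣ c ∣ G _ (begin-strict
  G + ∣ c ∣                      <⟨ G+∣c∣<∣j∣ ⟩
  ∣ j ∣                          ≡⟨ cong ∣_∣ (j≡j+c-c j c) ⟩
  ∣ j ℤ.+ c ℤ.+ ℤ.- c ∣          ≤⟨ ℤP.∣i+j∣≤∣i∣+∣j∣ (j ℤ.+ c) (ℤ.- c) ⟩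
  ∣ j ℤ.+ c ∣ + ∣ ℤ.- c ∣        ≡⟨ cong (_+_ ∣ j ℤ.+ c ∣) (ℤP.∣-i∣≡∣i∣ c) ⟩
  ∣ j ℤ.+ c ∣ + ∣ c ∣            ∎))
  where
  open ℕP.≤-Reasoning
  j≡j+c-c : ∀ j c → j ≡ j ℤ.+ c ℤ.+ ℤ.- c
  j≡j+c-c = ℤRing.solve-∀

module _ {G : ℕ} {h : ℤ → ℕ} (supp : SupportedIn₁ G h) where

  sumWindow-shift-down-invariant : ∀ {F} → G < F → sumWindow F (λ j → h (j ℤ.- 1ℤ)) ≡ sumWindow F h
  sumWindow-shift-down-invariant {F} G<F = ℕP.+-cancelʳ-≡ 0 _ _ (begin
    sumWindow F (λ j → h (j ℤ.- 1ℤ)) + 0      ≡⟨ cong (_+_ _) (supp (+ F) G<F) ⟨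
    sumWindow F (λ j → h (j ℤ.- 1ℤ)) + h (+ F) ≡⟨ sumWindow-shift-down F h ⟩
    sumWindow F h + h -[1+ F ]               ≡⟨ cong (_+_ _) (supp -[1+ F ] (ℕP.m≤n⇒m≤1+n G<F)) ⟩
    sumWindow F h + 0                        ∎)
    where open ≡-Reasoning

  sumWindow-shift-up-invariant : ∀ {F} → G < F → sumWindow F (λ j → h (j ℤ.+ 1ℤ)) ≡ sumWindow F h
  sumWindow-shift-up-invariant {F} G<F = ℕP.+-cancelʳ-≡ 0 _ _ (begin
    sumWindow F (λ j → h (j ℤ.+ 1ℤ)) + 0           ≡⟨ cong (_+_ _) (supp (ℤ.- + F) G<∣-F∣) ⟨
    sumWindow F (λ j → h (j ℤ.+ 1ℤ)) + h (ℤ.- + F) ≡⟨ sumWindow-shift-up F h ⟩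
    sumWindow F h + h (+ suc F)                    ≡⟨ cong (_+_ _) (supp (+ suc F) (ℕP.m≤n⇒m≤1+n G<F)) ⟩
    sumWindow F h + 0                              ∎)
    where
    open ≡-Reasoning
    G<∣-F∣ : G < ∣ ℤ.- + F ∣
    G<∣-F∣ = subst (G <_) (sym (ℤP.∣-i∣≡∣i∣ (+ F))) G<F

sumWindow-translate-down : ∀ F {G h} n → SupportedIn₁ G h → G + n ≤ F →
                           sumWindow F (λ j → h (j ℤ.- + n)) ≡ sumWindow F h
sumWindow-translate-down F {h = h} zero supp _ = sumWindow-cong F (λ j → cong h (ℤP.+-identityʳ j))
sumWindow-translate-down F {G} {h} (suc n) supp G+1+n≤F = begin
  sumWindow F (λ j → h (j ℤ.- + suc n))   ≡⟨ sumWindow-cong F (λ j → cong h (regroup j (+ n))) ⟩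
  sumWindow F (λ j → h′ (j ℤ.- 1ℤ))       ≡⟨ sumWindow-shift-down-invariant supp′ G+n<F ⟩
  sumWindow F h′                          ≡⟨ sumWindow-translate-down F n supp (ℕP.<⇒≤ G+n<F) ⟩
  sumWindow F h                           ∎
  where
  open ≡-Reasoning
  h′ = λ j → h (j ℤ.- + n)
  G+n<F : G + n < F
  G+n<F = subst (_≤ F) (ℕP.+-suc G n) G+1+n≤F
  supp′ : SupportedIn₁ (G + n) h′
  supp′ = subst (λ x → SupportedIn₁ (G + x) h′) (ℤP.∣-i∣≡∣i∣ (+ n)) (SupportedIn₁-translate (ℤ.- + n) supp)
  regroup : ∀ j n → j ℤ.- (1ℤ ℤ.+ n) ≡ j ℤ.- 1ℤ ℤ.- n
  regroup = ℤRing.solve-∀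

sumWindow-translate-up : ∀ F {G h} n → SupportedIn₁ G h → G + n ≤ F →
                         sumWindow F (λ j → h (j ℤ.+ + n)) ≡ sumWindow F h
sumWindow-translate-up F {h = h} zero supp _ = sumWindow-cong F (λ j → cong h (ℤP.+-identityʳ j))
sumWindow-translate-up F {G} {h} (suc n) supp G+1+n≤F = begin
  sumWindow F (λ j → h (j ℤ.+ + suc n))   ≡⟨ sumWindow-cong F (λ j → cong h (regroup j (+ n))) ⟩
  sumWindow F (λ j → h′ (j ℤ.+ 1ℤ))       ≡⟨ sumWindow-shift-up-invariant (SupportedIn₁-translate (+ n) supp) G+n<F ⟩
  sumWindow F h′                          ≡⟨ sumWindow-translate-up F n supp (ℕP.<⇒≤ G+n<F) ⟩
  sumWindow F h                           ∎
  where
  open ≡-Reasoning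
  h′ = λ j → h (j ℤ.+ + n)
  G+n<F : G + n < F
  G+n<F = subst (_≤ F) (ℕP.+-suc G n) G+1+n≤F
  regroup : ∀ j n → j ℤ.+ (1ℤ ℤ.+ n) ≡ j ℤ.+ 1ℤ ℤ.+ n
  regroup = ℤRing.solve-∀

sumWindow-translate : ∀ F {G h} c → SupportedIn₁ G h → G + ∣ c ∣ ≤ F →
                      sumWindow F (λ j → h (j ℤ.- c)) ≡ sumWindow F h
sumWindow-translate F (+ n)    = sumWindow-translate-down F n
sumWindow-translate F -[1+ n ] = sumWindow-translate-up F (suc n)

sumCube : ∀ {k} → ℕ → (ℤ^ k → ℕ) → ℕ
sumCube {zero}  F f = f 0v
sumCube {suc k} F f = sumWindow F (λ j → sumCube F (λ u → f (j ∷ᵛ u)))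

SupportedIn : ∀ {k} → ℕ → (ℤ^ k → ℕ) → Set
SupportedIn G f = ∀ v i → G < ∣ v i ∣ → f v ≡ 0

module _ (F : ℕ) where

  sumCube-cong : ∀ {k} {f f′ : ℤ^ k → ℕ} → (∀ v → f v ≡ f′ v) → sumCube F f ≡ sumCube F f′
  sumCube-cong {zero}  e = e 0v
  sumCube-cong {suc k} e = sumWindow-cong F (λ j → sumCube-cong (λ u → e (j ∷ᵛ u)))

  sumCube-mono : ∀ {k} {f f′ : ℤ^ k → ℕ} → (∀ v → f v ≤ f′ v) → sumCube F f ≤ sumCube F f′
  sumCube-mono {zero}  e = e 0v
  sumCube-mono {suc k} e = sumWindow-mono F (λ j → sumCube-mono (λ u → e (j ∷ᵛ u)))

  sumCube-+ : ∀ {k} (f f′ : ℤ^ k → ℕ) → sumCube F (λ v → f v + f′ v) ≡ sumCube F f + sumCube F f′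
  sumCube-+ {zero}  f f′ = refl
  sumCube-+ {suc k} f f′ =
    trans (sumWindow-cong F (λ j → sumCube-+ (λ u → f (j ∷ᵛ u)) (λ u → f′ (j ∷ᵛ u))))
          (sumWindow-+ F _ _)

  sumCube-*ˡ : ∀ {k} c (f : ℤ^ k → ℕ) → sumCube F (λ v → c * f v) ≡ c * sumCube F f
  sumCube-*ˡ {zero}  c f = refl
  sumCube-*ˡ {suc k} c f =
    trans (sumWindow-cong F (λ j → sumCube-*ˡ c (λ u → f (j ∷ᵛ u)))) (sumWindow-*ˡ F c _)

  sumCube-zero : ∀ {k} (f : ℤ^ k → ℕ) → (∀ v → f v ≡ 0) → sumCube F f ≡ 0
  sumCube-zero f f≡0 = trans (sumCube-cong {f′ = λ v → 0 * f v} f≡0) (sumCube-*ˡ 0 f)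

  centre≤sumCube : ∀ {k} (f : ℤ^ k → ℕ) → f Preserves _≈_ ⟶ _≡_ → f 0v ≤ sumCube F f
  centre≤sumCube {zero}  f f-resp = ℕP.≤-refl
  centre≤sumCube {suc k} f f-resp = begin
    f 0v                             ≡⟨ f-resp (λ { zero → refl ; (suc i) → refl }) ⟩
    f (0ℤ ∷ᵛ 0v)                     ≤⟨ centre≤sumCube (λ u → f (0ℤ ∷ᵛ u)) (λ e → f-resp (∷ᵛ-cong e)) ⟩
    sumCube F (λ u → f (0ℤ ∷ᵛ u))    ≤⟨ centre≤sumWindow F _ ⟩
    sumCube F f                      ∎
    where open ℕP.≤-Reasoning

  sumCube-translate : ∀ {k G} (f : ℤ^ k → ℕ) g → f Preserves _≈_ ⟶ _≡_ → SupportedIn G f →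
                      (∀ i → G + ∣ g i ∣ ≤ F) → sumCube F (λ v → f (v -v g)) ≡ sumCube F f
  sumCube-translate {zero}  f g f-resp supp small = f-resp (λ ())
  sumCube-translate {suc k} {G} f g f-resp supp small = begin
    sumWindow F (λ j → sumCube F (λ u → f ((j ∷ᵛ u) -v g)))
      ≡⟨ sumWindow-cong F (λ j → sumCube-cong (λ u → f-resp (∷ᵛ--v j u))) ⟩
    sumWindow F (λ j → sumCube F (λ u → f ((j ℤ.- head g) ∷ᵛ (u -v tail g))))
      ≡⟨ sumWindow-cong F (λ j → sumCube-translate (λ u → f ((j ℤ.- head g) ∷ᵛ u)) (tail g)
                                   (λ e → f-resp (∷ᵛ-cong e)) (λ v i → supp _ (suc i)) (λ i → small (suc i))) ⟩
    sumWindow F (λ j → H (j ℤ.- head g))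
      ≡⟨ sumWindow-translate F (head g) H-supported (small zero) ⟩
    sumWindow F H ∎
    where
    open ≡-Reasoning
    H : ℤ → ℕ
    H j = sumCube F (λ u → f (j ∷ᵛ u))
    H-supported : SupportedIn₁ G H
    H-supported j G<∣j∣ = sumCube-zero _ (λ u → supp (j ∷ᵛ u) zero G<∣j∣)
    ∷ᵛ--v : ∀ j u → (j ∷ᵛ u) -v g ≈ (j ℤ.- head g) ∷ᵛ (u -v tail g)
    ∷ᵛ--v j u zero    = refl
    ∷ᵛ--v j u (suc i) = refl

-- Weights

^-distrib-* : ∀ x y n → (x * y) ^ n ≡ x ^ n * y ^ n
^-distrib-* x y zero    = refl
^-distrib-* x y (suc n) = trans (cong (x * y *_) (^-distrib-* x y n)) (interchange x y (x ^ n) (y ^ n))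
  where
  interchange : ∀ x y p q → x * y * (p * q) ≡ x * p * (y * q)
  interchange = ℕRing.solve-∀

ratio-decay : ∀ {a b K n p q X Y} → a ≤ b → .{{ℕ.NonZero b}} →
              X * b ^ p ≡ a ^ p * K → Y * b ^ q ≡ a ^ q * K → q ≤ n + p → a ^ n * X ≤ b ^ n * Y
ratio-decay {a} {b} {K} {n} {p} {q} {X} {Y} a≤b X-ratio Y-ratio q≤n+p =
  ℕP.*-cancelʳ-≤ _ _ (b ^ p * b ^ q) {{ℕP.m*n≢0 _ _ {{ℕP.m^n≢0 b p}} {{ℕP.m^n≢0 b q}}}} (begin
    a ^ n * X * (b ^ p * b ^ q)      ≡⟨ regroup (a ^ n) X (b ^ p) (b ^ q) ⟩
    a ^ n * (X * b ^ p) * b ^ q      ≡⟨ cong (λ z → a ^ n * z * b ^ q) X-ratio ⟩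
    a ^ n * (a ^ p * K) * b ^ q      ≡⟨ cong (λ z → z * b ^ q) (sym (ℕP.*-assoc (a ^ n) (a ^ p) K)) ⟩
    a ^ n * a ^ p * K * b ^ q        ≡⟨ cong (λ z → z * K * b ^ q) (trans (sym (ℕP.^-distribˡ-+-* a n p))
                                                                        (cong (a ^_) (sym q+e≡n+p))) ⟩
    a ^ (q + e) * K * b ^ q          ≡⟨ cong (λ z → z * K * b ^ q) (ℕP.^-distribˡ-+-* a q e) ⟩
    a ^ q * a ^ e * K * b ^ q        ≤⟨ ℕP.*-monoˡ-≤ (b ^ q) (ℕP.*-monoˡ-≤ K (ℕP.*-monoʳ-≤ (a ^ q) (ℕP.^-monoˡ-≤ e a≤b))) ⟩
    a ^ q * b ^ e * K * b ^ q        ≡⟨ regroup′ (a ^ q) (b ^ e) K (b ^ q) ⟩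
    b ^ e * b ^ q * (a ^ q * K)      ≡⟨ cong₂ _*_ (trans (sym (ℕP.^-distribˡ-+-* b e q))
                                                        (cong (b ^_) (trans (ℕP.+-comm e q) q+e≡n+p)))
                                                 (sym Y-ratio) ⟩
    b ^ (n + p) * (Y * b ^ q)        ≡⟨ cong (_* (Y * b ^ q)) (ℕP.^-distribˡ-+-* b n p) ⟩
    b ^ n * b ^ p * (Y * b ^ q)      ≡⟨ regroup″ (b ^ n) (b ^ p) Y (b ^ q) ⟩
    b ^ n * Y * (b ^ p * b ^ q)      ∎)
  where
  open ℕP.≤-Reasoning
  e = n + p ∸ q
  q+e≡n+p : q + e ≡ n + p
  q+e≡n+p = ℕP.m+[n∸m]≡n q≤n+p
  regroup : ∀ A x c d → A * x * (c * d) ≡ A * (x * c) * d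
  regroup = ℕRing.solve-∀
  regroup′ : ∀ A E K Q → A * E * K * Q ≡ E * Q * (A * K)
  regroup′ = ℕRing.solve-∀
  regroup″ : ∀ N P y Q → N * P * (y * Q) ≡ N * y * (P * Q)
  regroup″ = ℕRing.solve-∀

-- On the cube [-F, F]^k, weight v = b^(kF) (a/b)^|v|₁ with b = a + 1.
module Weights (a F : ℕ) where

  b : ℕ
  b = suc a

  ψ : ℕ → ℕ
  ψ x = a ^ x * b ^ (F ∸ x)

  φ : ℤ → ℕ
  φ j = ψ ∣ j ∣

  weight : ∀ {k} → ℤ^ k → ℕ
  weight {zero}  v = 1
  weight {suc k} v = φ (head v) * weight (tail v)

  weight-resp : ∀ {k} → weight {k} Preserves _≈_ ⟶ _≡_
  weight-resp {zero}  e = refl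
  weight-resp {suc k} e = cong₂ _*_ (cong φ (e zero)) (weight-resp (λ i → e (suc i)))

  -- The geometric series telescopes because b - a = 1.
  sumWindow-φ : ∀ m → m ≤ F → sumWindow m φ + 2 * (a ^ suc m * b ^ (F ∸ m)) ≡ (a + b) * b ^ F
  sumWindow-φ zero    _   = base a (b ^ F)
    where
    base : ∀ a X → 1 * X + 2 * (a * 1 * X) ≡ (a + (1 + a)) * X
    base = ℕRing.solve-∀
  sumWindow-φ (suc m) m<F = begin
    sumWindow m φ + (A * B + A * B) + 2 * (a ^ suc (suc m) * B) ≡⟨ regroup (sumWindow m φ) A B a ⟩
    sumWindow m φ + 2 * (A * (b * B))                         ≡⟨ cong (λ x → sumWindow m φ + 2 * (A * b ^ x))
                                                                      (sym (ℕP.+-∸-assoc 1 m<F)) ⟩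
    sumWindow m φ + 2 * (A * b ^ (F ∸ m))                     ≡⟨ sumWindow-φ m (ℕP.<⇒≤ m<F) ⟩
    (a + b) * b ^ F                                           ∎
    where
    open ≡-Reasoning
    A = a ^ suc m
    B = b ^ (F ∸ suc m)
    regroup : ∀ S A B a → S + (A * B + A * B) + 2 * ((a * A) * B) ≡ S + 2 * (A * ((1 + a) * B))
    regroup = ℕRing.solve-∀

  sumCube-weight : ∀ {k} → sumCube F (weight {k}) ≤ ((a + b) * b ^ F) ^ k
  sumCube-weight {zero}  = ℕP.≤-refl
  sumCube-weight {suc k} = begin
    sumWindow F (λ j → sumCube F (λ (u : ℤ^ k) → φ j * weight u))
      ≡⟨ sumWindow-cong F (λ j → trans (sumCube-*ˡ F (φ j) (weight {k})) (ℕP.*-comm (φ j) W)) ⟩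
    sumWindow F (λ j → W * φ j)                ≡⟨ sumWindow-*ˡ F W φ ⟩
    W * sumWindow F φ                          ≤⟨ ℕP.*-mono-≤ (sumCube-weight {k}) sumWindow-φ-≤ ⟩
    ((a + b) * b ^ F) ^ k * ((a + b) * b ^ F)  ≡⟨ ℕP.*-comm _ ((a + b) * b ^ F) ⟩
    ((a + b) * b ^ F) ^ suc k                  ∎
    where
    open ℕP.≤-Reasoning
    W = sumCube F (weight {k})
    sumWindow-φ-≤ : sumWindow F φ ≤ (a + b) * b ^ F
    sumWindow-φ-≤ = ℕP.≤-trans (ℕP.m≤m+n _ _) (ℕP.≤-reflexive (sumWindow-φ F ℕP.≤-refl))

  weight-0v : ∀ {k} → weight (0v {k}) ≡ b ^ (k * F)
  weight-0v {zero}  = refl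
  weight-0v {suc k} = begin
    1 * b ^ F * weight (0v {k}) ≡⟨ cong₂ _*_ (ℕP.*-identityˡ (b ^ F)) (weight-0v {k}) ⟩
    b ^ F * b ^ (k * F)         ≡⟨ ℕP.^-distribˡ-+-* b F (k * F) ⟨
    b ^ (F + k * F)             ∎
    where open ≡-Reasoning

  weight-ratio : ∀ {k} (v : ℤ^ k) → (∀ i → ∣ v i ∣ ≤ F) → weight v * b ^ norm1 v ≡ a ^ norm1 v * b ^ (k * F)
  weight-ratio {zero}  v small = refl
  weight-ratio {suc k} v small = begin
    ψ x * weight (tail v) * b ^ (x + y)         ≡⟨ cong (ψ x * weight (tail v) *_) (ℕP.^-distribˡ-+-* b x y) ⟩
    ψ x * weight (tail v) * (b ^ x * b ^ y)     ≡⟨ interchange (ψ x) (weight (tail v)) (b ^ x) (b ^ y) ⟩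
    (ψ x * b ^ x) * (weight (tail v) * b ^ y)   ≡⟨ cong₂ _*_ ψ-ratio (weight-ratio (tail v) (λ i → small (suc i))) ⟩
    (a ^ x * b ^ F) * (a ^ y * b ^ (k * F))     ≡⟨ interchange′ (a ^ x) (b ^ F) (a ^ y) (b ^ (k * F)) ⟩
    (a ^ x * a ^ y) * (b ^ F * b ^ (k * F))     ≡⟨ cong₂ _*_ (ℕP.^-distribˡ-+-* a x y) (ℕP.^-distribˡ-+-* b F (k * F)) ⟨
    a ^ (x + y) * b ^ (F + k * F)               ∎
    where
    open ≡-Reasoning
    x = ∣ head v ∣
    y = norm1 (tail v)
    ψ-ratio : ψ x * b ^ x ≡ a ^ x * b ^ F
    ψ-ratio = begin
      a ^ x * b ^ (F ∸ x) * b ^ x   ≡⟨ ℕP.*-assoc (a ^ x) _ _ ⟩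
      a ^ x * (b ^ (F ∸ x) * b ^ x) ≡⟨ cong (a ^ x *_) (ℕP.^-distribˡ-+-* b (F ∸ x) x) ⟨
      a ^ x * b ^ (F ∸ x + x)       ≡⟨ cong (λ e → a ^ x * b ^ e) (ℕP.m∸n+n≡m (small zero)) ⟩
      a ^ x * b ^ F                 ∎
    interchange : ∀ p w c d → p * w * (c * d) ≡ (p * c) * (w * d)
    interchange = ℕRing.solve-∀
    interchange′ : ∀ p q r s → (p * q) * (r * s) ≡ (p * r) * (q * s)
    interchange′ = ℕRing.solve-∀

  weight-decay : ∀ {k} n (u v : ℤ^ k) → (∀ i → ∣ u i ∣ ≤ F) → (∀ i → ∣ v i ∣ ≤ F) →
                 norm1 v ≤ n + norm1 u → a ^ n * weight u ≤ b ^ n * weight v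
  weight-decay n u v u-small v-small =
    ratio-decay {n = n} {X = weight u} {Y = weight v} (ℕP.n≤1+n a) (weight-ratio u u-small) (weight-ratio v v-small)

-- Short chains are short

InBall : ∀ {k} → List (ℤ^ k) → ℕ → ℤ^ k → Set
InBall S N v = Span S v × norm1 v ≤ N

InBall? : ∀ {k} (S : List (ℤ^ k)) N v → Dec (InBall S N v)
InBall? S N v = Span? S v ×-dec norm1 v ℕ.≤? N

module Potential (a F : ℕ) where

  open Weights a F

  ballWeight : ∀ {k} → List (ℤ^ k) → ℕ → ℤ^ k → ℕ
  ballWeight S N v with InBall? S N v
  ... | yes _ = weight v
  ... | no  _ = 0

  ballWeight-in : ∀ {k} {S : List (ℤ^ k)} {N v} → InBall S N v → ballWeight S N v ≡ weight v
  ballWeight-in {S = S} {N} {v} in-ball with InBall? S N v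
  ... | yes _      = refl
  ... | no ¬in-ball = contradiction in-ball ¬in-ball

  ballWeight-out : ∀ {k} {S : List (ℤ^ k)} {N v} → ¬ InBall S N v → ballWeight S N v ≡ 0
  ballWeight-out {S = S} {N} {v} ¬in-ball with InBall? S N v
  ... | yes in-ball = contradiction in-ball ¬in-ball
  ... | no  _       = refl

  ballWeight-≤ : ∀ {k} (S : List (ℤ^ k)) N v → ballWeight S N v ≤ weight v
  ballWeight-≤ S N v with InBall? S N v
  ... | yes _ = ℕP.≤-refl
  ... | no  _ = z≤n

  ballWeight-resp : ∀ {k} (S : List (ℤ^ k)) N → ballWeight S N Preserves _≈_ ⟶ _≡_
  ballWeight-resp S N {u} {v} u≈v with InBall? S N u | InBall? S N v
  ... | yes _ | yes _ = weight-resp u≈v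
  ... | no  _ | no  _ = refl
  ... | yes (u∈ , ‖u‖≤N) | no ¬in-ball =
    contradiction (≈∈ u≈v u∈ , subst (_≤ N) (norm1-resp u≈v) ‖u‖≤N) ¬in-ball
  ... | no ¬in-ball | yes (v∈ , ‖v‖≤N) =
    contradiction (≈∈ (λ i → sym (u≈v i)) v∈ , subst (_≤ N) (sym (norm1-resp u≈v)) ‖v‖≤N) ¬in-ball

  ballWeight-supported : ∀ {k} (S : List (ℤ^ k)) N → SupportedIn N (ballWeight S N)
  ballWeight-supported S N v i N<∣vᵢ∣ =
    ballWeight-out {S = S} {N} {v} λ { (_ , ‖v‖≤N) → ℕP.<⇒≱ N<∣vᵢ∣ (ℕP.≤-trans (∣coord∣≤norm1 v i) ‖v‖≤N) }

  potential : ∀ {k} → List (ℤ^ k) → ℕ → ℕ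
  potential S N = sumCube F (ballWeight S N)

  potential-≤ : ∀ {k} (S : List (ℤ^ k)) N → potential S N ≤ ((a + b) * b ^ F) ^ k
  potential-≤ {k} S N = ℕP.≤-trans (sumCube-mono F (ballWeight-≤ S N)) (sumCube-weight {k})

  module _ {k} {S : List (ℤ^ k)} {g : ℤ^ k} {n N : ℕ}
           (g∉S : ¬ Span S g) (‖g‖≤n : norm1 g ≤ n) (n+N≤F : n + N ≤ F) where

    private
      v≈v-g+g : ∀ v → v ≈ (v -v g) +v g
      v≈v-g+g v i = sym (x-y+y≡x (v i) (g i))
        where x-y+y≡x : ∀ x y → x ℤ.- y ℤ.+ y ≡ x
              x-y+y≡x = ℤRing.solve-∀

      coords≤F : ∀ (v : ℤ^ k) {M} → norm1 v ≤ M → M ≤ F → ∀ i → ∣ v i ∣ ≤ F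
      coords≤F v ‖v‖≤M M≤F i = ℕP.≤-trans (∣coord∣≤norm1 v i) (ℕP.≤-trans ‖v‖≤M M≤F)

      ball-grows : ∀ {v} → InBall S N v → InBall (g ∷ S) (n + N) v
      ball-grows (v∈ , ‖v‖≤N) = Span-∷ v∈ , ℕP.≤-trans ‖v‖≤N (ℕP.m≤n+m N n)

      ‖v‖≤n+‖v-g‖ : ∀ v → norm1 v ≤ n + norm1 (v -v g)
      ‖v‖≤n+‖v-g‖ v = begin
        norm1 v                  ≡⟨ norm1-resp (v≈v-g+g v) ⟩
        norm1 ((v -v g) +v g)    ≤⟨ norm1-+ (v -v g) g ⟩
        norm1 (v -v g) + norm1 g ≤⟨ ℕP.+-monoʳ-≤ (norm1 (v -v g)) ‖g‖≤n ⟩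
        norm1 (v -v g) + n       ≡⟨ ℕP.+-comm _ n ⟩
        n + norm1 (v -v g)       ∎
        where open ℕP.≤-Reasoning

      ball-translates : ∀ {v} → InBall S N (v -v g) → InBall (g ∷ S) (n + N) v
      ball-translates {v} (w∈ , ‖w‖≤N) =
        ≈∈ (λ i → sym (v≈v-g+g v i)) (+∈ (Span-∷ w∈) (gen (here refl))) ,
        ℕP.≤-trans (‖v‖≤n+‖v-g‖ v) (ℕP.+-monoʳ-≤ n ‖w‖≤N)

      translate-decay : ∀ {v} → InBall S N (v -v g) → a ^ n * weight (v -v g) ≤ b ^ n * weight v
      translate-decay {v} w-in@(_ , ‖w‖≤N) =
        weight-decay n (v -v g) v (coords≤F (v -v g) ‖w‖≤N (ℕP.≤-trans (ℕP.m≤n+m N n) n+N≤F))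
                                  (coords≤F v (proj₂ (ball-translates {v} w-in)) n+N≤F)
                                  (‖v‖≤n+‖v-g‖ v)

    -- Span (g ∷ S) contains the short points of Span S and, disjointly since g ∉ Span S, their
    -- translates by g.
    ballWeight-step : ∀ v → b ^ n * ballWeight S N v + a ^ n * ballWeight S N (v -v g)
                            ≤ b ^ n * ballWeight (g ∷ S) (n + N) v
    ballWeight-step v = by-cases (InBall? S N v) (InBall? S N (v -v g))
      where
      combine : ℕ → ℕ → ℕ
      combine x y = b ^ n * x + a ^ n * y
      combine-x-0 : ∀ B A x → B * x + A * 0 ≡ B * x
      combine-x-0 = ℕRing.solve-∀
      combine-0-y : ∀ B A y → B * 0 + A * y ≡ A * y
      combine-0-y = ℕRing.solve-∀
      by-cases : Dec (InBall S N v) → Dec (InBall S N (v -v g)) →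
                 combine (ballWeight S N v) (ballWeight S N (v -v g)) ≤ b ^ n * ballWeight (g ∷ S) (n + N) v
      by-cases (yes (v∈ , _)) (yes (w∈ , _)) = contradiction (≈∈ (λ i → x-[x-y]≡y (v i) (g i)) (-∈ v∈ w∈)) g∉S
        where x-[x-y]≡y : ∀ x y → x ℤ.- (x ℤ.- y) ≡ y
              x-[x-y]≡y = ℤRing.solve-∀
      by-cases (yes v-in) (no w-out) =
        subst₂ _≤_ (sym (trans (cong₂ combine (ballWeight-in v-in) (ballWeight-out w-out))
                               (combine-x-0 (b ^ n) (a ^ n) (weight v))))
                   (cong (b ^ n *_) (sym (ballWeight-in (ball-grows v-in))))
                   ℕP.≤-refl
      by-cases (no v-out) (yes w-in) =
        subst₂ _≤_ (sym (trans (cong₂ combine (ballWeight-out v-out) (ballWeight-in w-in))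
                               (combine-0-y (b ^ n) (a ^ n) (weight (v -v g)))))
                   (cong (b ^ n *_) (sym (ballWeight-in (ball-translates {v} w-in))))
                   (translate-decay {v} w-in)
      by-cases (no v-out) (no w-out) =
        subst (_≤ b ^ n * ballWeight (g ∷ S) (n + N) v)
              (sym (trans (cong₂ combine (ballWeight-out v-out) (ballWeight-out w-out))
                          (trans (combine-0-y (b ^ n) (a ^ n) 0) (ℕP.*-zeroʳ (a ^ n)))))
              z≤n

    potential-step : (b ^ n + a ^ n) * potential S N ≤ b ^ n * potential (g ∷ S) (n + N)
    potential-step = begin
      (b ^ n + a ^ n) * potential S N
        ≡⟨ ℕP.*-distribʳ-+ (potential S N) (b ^ n) (a ^ n) ⟩
      b ^ n * potential S N + a ^ n * potential S N
        ≡⟨ cong (λ x → b ^ n * potential S N + a ^ n * x)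
                (sumCube-translate F (ballWeight S N) g (ballWeight-resp S N) (ballWeight-supported S N) g-small) ⟨
      b ^ n * potential S N + a ^ n * sumCube F (λ v → ballWeight S N (v -v g))
        ≡⟨ cong₂ _+_ (sumCube-*ˡ F (b ^ n) (ballWeight S N)) (sumCube-*ˡ F (a ^ n) (λ v → ballWeight S N (v -v g))) ⟨
      sumCube F (λ v → b ^ n * ballWeight S N v) + sumCube F (λ v → a ^ n * ballWeight S N (v -v g))
        ≡⟨ sumCube-+ F (λ v → b ^ n * ballWeight S N v) (λ v → a ^ n * ballWeight S N (v -v g)) ⟨
      sumCube F (λ v → b ^ n * ballWeight S N v + a ^ n * ballWeight S N (v -v g))
        ≤⟨ sumCube-mono F ballWeight-step ⟩
      sumCube F (λ v → b ^ n * ballWeight (g ∷ S) (n + N) v)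
        ≡⟨ sumCube-*ˡ F (b ^ n) (ballWeight (g ∷ S) (n + N)) ⟩
      b ^ n * potential (g ∷ S) (n + N) ∎
      where
      open ℕP.≤-Reasoning
      g-small : ∀ i → N + ∣ g i ∣ ≤ F
      g-small i = ℕP.≤-trans (ℕP.+-monoʳ-≤ N (ℕP.≤-trans (∣coord∣≤norm1 g i) ‖g‖≤n))
                             (ℕP.≤-trans (ℕP.≤-reflexive (ℕP.+-comm N n)) n+N≤F)

  potential-chain : ∀ {k n} {S : List (ℤ^ k)} → ShortChain n S → length S * n ≤ F →
                    (a ^ n + b ^ n) ^ length S * weight (0v {k}) ≤ b ^ (length S * n) * potential S (length S * n)
  potential-chain {k} [] _ = ℕP.+-monoˡ-≤ 0 (begin
    weight (0v {k})               ≡⟨ ballWeight-in {S = []} {0} {0v {k}} (0∈ , ℕP.≤-reflexive (norm1-0v {k})) ⟨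
    ballWeight [] 0 (0v {k})      ≤⟨ centre≤sumCube F (ballWeight {k} [] 0) (ballWeight-resp [] 0) ⟩
    potential {k} [] 0            ∎)
    where open ℕP.≤-Reasoning
  potential-chain {k} {n} {g ∷ S} (step g∉S ‖g‖≤n chain) rn≤F = begin
    (A + B) * (A + B) ^ r * w₀
      ≡⟨ ℕP.*-assoc (A + B) _ w₀ ⟩
    (A + B) * ((A + B) ^ r * w₀)
      ≤⟨ ℕP.*-monoʳ-≤ (A + B) (potential-chain chain (ℕP.≤-trans (ℕP.m≤n+m (r * n) n) rn≤F)) ⟩
    (A + B) * (b ^ (r * n) * potential S (r * n))
      ≡⟨ regroup A B (b ^ (r * n)) (potential S (r * n)) ⟩
    b ^ (r * n) * ((B + A) * potential S (r * n))
      ≤⟨ ℕP.*-monoʳ-≤ (b ^ (r * n)) (potential-step g∉S ‖g‖≤n rn≤F) ⟩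
    b ^ (r * n) * (B * potential (g ∷ S) (n + r * n))
      ≡⟨ regroup′ (b ^ (r * n)) B _ ⟩
    B * b ^ (r * n) * potential (g ∷ S) (n + r * n)
      ≡⟨ cong (_* potential (g ∷ S) (n + r * n)) (ℕP.^-distribˡ-+-* b n (r * n)) ⟨
    b ^ (n + r * n) * potential (g ∷ S) (n + r * n) ∎
    where
    open ℕP.≤-Reasoning
    r = length S
    A = a ^ n
    B = b ^ n
    w₀ = weight (0v {k})
    regroup : ∀ A B C P → (A + B) * (C * P) ≡ C * ((B + A) * P)
    regroup = ℕRing.solve-∀
    regroup′ : ∀ C B P → C * (B * P) ≡ B * C * P
    regroup′ = ℕRing.solve-∀

chain-bound : ∀ {k n} a {S : List (ℤ^ k)} → ShortChain n S →
              (a ^ n + suc a ^ n) ^ length S ≤ suc a ^ (length S * n) * (a + suc a) ^ k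
chain-bound {k} {n} a {S} chain = ℕP.*-cancelʳ-≤ _ _ (b ^ (k * F)) {{ℕP.m^n≢0 b (k * F)}} (begin
  (a ^ n + b ^ n) ^ r * b ^ (k * F)          ≡⟨ cong ((a ^ n + b ^ n) ^ r *_) (Weights.weight-0v a F {k}) ⟨
  (a ^ n + b ^ n) ^ r * Weights.weight a F (0v {k}) ≤⟨ Potential.potential-chain a F chain ℕP.≤-refl ⟩
  b ^ F * Potential.potential a F S F        ≤⟨ ℕP.*-monoʳ-≤ (b ^ F) (Potential.potential-≤ a F S F) ⟩
  b ^ F * ((a + b) * b ^ F) ^ k              ≡⟨ cong (b ^ F *_) (^-distrib-* (a + b) (b ^ F) k) ⟩
  b ^ F * ((a + b) ^ k * (b ^ F) ^ k)        ≡⟨ cong (λ x → b ^ F * ((a + b) ^ k * x))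
                                                     (trans (ℕP.^-*-assoc b F k) (cong (b ^_) (ℕP.*-comm F k))) ⟩
  b ^ F * ((a + b) ^ k * b ^ (k * F))        ≡⟨ ℕP.*-assoc (b ^ F) _ _ ⟨
  b ^ F * (a + b) ^ k * b ^ (k * F)          ∎)
  where
  open ℕP.≤-Reasoning
  b = suc a
  r = length S
  F = r * n

[1+a]^[1+j]≤ : ∀ a j → suc a * suc a ^ j ≤ suc a * a ^ j + j * suc a ^ j
[1+a]^[1+j]≤ a zero    = ℕP.≤-reflexive (sym (ℕP.+-identityʳ _))
[1+a]^[1+j]≤ a (suc j) = begin
  b * (b * b ^ j)                          ≤⟨ ℕP.*-monoʳ-≤ b ([1+a]^[1+j]≤ a j) ⟩
  b * (b * a ^ j + j * b ^ j)              ≡⟨ expand a (a ^ j) j (b ^ j) ⟩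
  b * (a * a ^ j) + a ^ j * b + j * (b * b ^ j)
    ≤⟨ ℕP.+-monoˡ-≤ (j * (b * b ^ j)) (ℕP.+-monoʳ-≤ (b * (a * a ^ j)) (ℕP.*-monoˡ-≤ b (ℕP.^-monoˡ-≤ j (ℕP.n≤1+n a)))) ⟩
  b * (a * a ^ j) + b ^ j * b + j * (b * b ^ j) ≡⟨ collect (b * (a * a ^ j)) (b ^ j) b j ⟩
  b * (a * a ^ j) + suc j * (b * b ^ j)    ∎
  where
  open ℕP.≤-Reasoning
  b = suc a
  expand : ∀ a A j B → (1 + a) * ((1 + a) * A + j * B) ≡ (1 + a) * (a * A) + A * (1 + a) + j * ((1 + a) * B)
  expand = ℕRing.solve-∀
  collect : ∀ X B b j → X + B * b + j * (b * B) ≡ X + (1 + j) * (b * B)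
  collect = ℕRing.solve-∀

[2n]^n≤2*[2n-1]^n : ∀ n′ → let n = suc n′ in (n + n) ^ n ≤ 2 * (n′ + n) ^ n
[2n]^n≤2*[2n-1]^n n′ = ℕP.*-cancelˡ-≤ n (ℕP.+-cancelʳ-≤ (n * B) (n * B) (n * (2 * A)) (begin
  n * B + n * B          ≡⟨ double n B ⟩
  (n + n) * B            ≤⟨ [1+a]^[1+j]≤ (n′ + n) n ⟩
  (n + n) * A + n * B    ≡⟨ cong (_+ n * B) (double′ n A) ⟩
  n * (2 * A) + n * B    ∎))
  where
  open ℕP.≤-Reasoning
  n = suc n′
  A = (n′ + n) ^ n
  B = (n + n) ^ n
  double : ∀ n B → n * B + n * B ≡ (n + n) * B
  double = ℕRing.solve-∀
  double′ : ∀ n A → (n + n) * A ≡ n * (2 * A)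
  double′ = ℕRing.solve-∀

2^[3t+e]≤3^[2t+e] : ∀ t e → 2 ^ (t + t + e) * 2 ^ t ≤ 3 ^ (t + t + e)
2^[3t+e]≤3^[2t+e] t e = begin
  2 ^ (t + t + e) * 2 ^ t        ≡⟨ split 2 ⟩
  2 ^ t * 2 ^ t * 2 ^ t * 2 ^ e  ≡⟨ cong (_* 2 ^ e) (sym (trans (^-distrib-* (2 * 2) 2 t) (cong (_* 2 ^ t) (^-distrib-* 2 2 t)))) ⟩
  8 ^ t * 2 ^ e                  ≤⟨ ℕP.*-mono-≤ (ℕP.^-monoˡ-≤ t (ℕP.n≤1+n 8)) (ℕP.^-monoˡ-≤ e (ℕP.n≤1+n 2)) ⟩
  9 ^ t * 3 ^ e                  ≡⟨ cong (_* 3 ^ e) (^-distrib-* 3 3 t) ⟩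
  3 ^ t * 3 ^ t * 3 ^ e          ≡⟨ cong (_* 3 ^ e) (ℕP.^-distribˡ-+-* 3 t t) ⟨
  3 ^ (t + t) * 3 ^ e            ≡⟨ ℕP.^-distribˡ-+-* 3 (t + t) e ⟨
  3 ^ (t + t + e)                ∎
  where
  open ℕP.≤-Reasoning
  split : ∀ x → x ^ (t + t + e) * x ^ t ≡ x ^ t * x ^ t * x ^ t * x ^ e
  split x = begin-equality
    x ^ (t + t + e) * x ^ t              ≡⟨ cong (_* x ^ t) (trans (ℕP.^-distribˡ-+-* x (t + t) e)
                                                                   (cong (_* x ^ e) (ℕP.^-distribˡ-+-* x t t))) ⟩
    x ^ t * x ^ t * x ^ e * x ^ t        ≡⟨ swap (x ^ t) (x ^ e) ⟩
    x ^ t * x ^ t * x ^ t * x ^ e        ∎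
    where
    swap : ∀ X E → X * X * E * X ≡ X * X * X * E
    swap = ℕRing.solve-∀

3^r≤2^r*2^M⇒r≤2M+1 : ∀ r M → 3 ^ r ≤ 2 ^ r * 2 ^ M → r ≤ M + M + 1
3^r≤2^r*2^M⇒r≤2M+1 r M 3^r≤ with r ℕ.≤? M + M + 1
... | yes r≤2M+1 = r≤2M+1
... | no  r≰2M+1 with ℕP.m≤n⇒∃[o]m+o≡n (ℕP.≰⇒> r≰2M+1)
...   | e , refl = ⊥-elim (ℕP.<⇒≱ (ℕP.^-monoʳ-< 2 (s≤s (s≤s z≤n)) (ℕP.n<1+n M))
                                  (ℕP.*-cancelˡ-≤ (2 ^ r) {{ℕP.m^n≢0 2 r}} (begin
    2 ^ r * 2 ^ t                   ≡⟨ cong (λ x → 2 ^ x * 2 ^ t) r≡2t+e ⟩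
    2 ^ (t + t + e) * 2 ^ t         ≤⟨ 2^[3t+e]≤3^[2t+e] t e ⟩
    3 ^ (t + t + e)                 ≡⟨ cong (3 ^_) r≡2t+e ⟨
    3 ^ r                           ≤⟨ 3^r≤ ⟩
    2 ^ r * 2 ^ M                   ∎)))
  where
  open ℕP.≤-Reasoning
  t = suc M
  r≡2t+e : suc (M + M + 1) + e ≡ t + t + e
  r≡2t+e = cong (_+ e) (rearrange M)
    where rearrange : ∀ M → suc (M + M + 1) ≡ suc M + suc M
          rearrange = ℕRing.solve-∀

short-chain-length : ∀ {k n L} {S : List (ℤ^ k)} → 1 ≤ n → ShortChain n S → 4 * n ≤ 2 ^ L →
                     length S ≤ L * k + L * k + 1
short-chain-length {k} {suc n′} {L} {S} _ chain 4n≤2^L = 3^r≤2^r*2^M⇒r≤2M+1 r (L * k)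
  (ℕP.*-cancelʳ-≤ _ _ (b ^ (r * n)) {{ℕP.m^n≢0 b (r * n)}} (begin
    3 ^ r * b ^ (r * n)              ≡⟨ cong (3 ^ r *_) (trans (cong (b ^_) (ℕP.*-comm r n)) (sym (ℕP.^-*-assoc b n r))) ⟩
    3 ^ r * (b ^ n) ^ r              ≡⟨ ^-distrib-* 3 (b ^ n) r ⟨
    (3 * b ^ n) ^ r                  ≤⟨ ℕP.^-monoˡ-≤ r 3b^n≤2[a^n+b^n] ⟩
    (2 * (a ^ n + b ^ n)) ^ r        ≡⟨ ^-distrib-* 2 (a ^ n + b ^ n) r ⟩
    2 ^ r * (a ^ n + b ^ n) ^ r      ≤⟨ ℕP.*-monoʳ-≤ (2 ^ r) (chain-bound a chain) ⟩
    2 ^ r * (b ^ (r * n) * (a + b) ^ k) ≤⟨ ℕP.*-monoʳ-≤ (2 ^ r) (ℕP.*-monoʳ-≤ (b ^ (r * n)) [a+b]^k≤2^Lk) ⟩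
    2 ^ r * (b ^ (r * n) * 2 ^ (L * k)) ≡⟨ regroup (2 ^ r) (b ^ (r * n)) (2 ^ (L * k)) ⟩
    2 ^ r * 2 ^ (L * k) * b ^ (r * n) ∎))
  where
  open ℕP.≤-Reasoning
  n = suc n′
  a = n′ + n
  b = n + n
  r = length S
  3b^n≤2[a^n+b^n] : 3 * b ^ n ≤ 2 * (a ^ n + b ^ n)
  3b^n≤2[a^n+b^n] = begin
    3 * b ^ n              ≡⟨ split (b ^ n) ⟩
    b ^ n + 2 * b ^ n      ≤⟨ ℕP.+-monoˡ-≤ (2 * b ^ n) ([2n]^n≤2*[2n-1]^n n′) ⟩
    2 * a ^ n + 2 * b ^ n  ≡⟨ ℕP.*-distribˡ-+ 2 (a ^ n) (b ^ n) ⟨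
    2 * (a ^ n + b ^ n)    ∎
    where split : ∀ x → 3 * x ≡ x + 2 * x
          split = ℕRing.solve-∀
  [a+b]^k≤2^Lk : (a + b) ^ k ≤ 2 ^ (L * k)
  [a+b]^k≤2^Lk = begin
    (a + b) ^ k   ≤⟨ ℕP.^-monoˡ-≤ k (ℕP.≤-trans (ℕP.n≤1+n (a + b)) (ℕP.≤-trans (ℕP.≤-reflexive (four n′)) 4n≤2^L)) ⟩
    (2 ^ L) ^ k   ≡⟨ ℕP.^-*-assoc 2 L k ⟩
    2 ^ (L * k)   ∎
    where four : ∀ n′ → suc (n′ + suc n′ + (suc n′ + suc n′)) ≡ 4 * suc n′
          four = ℕRing.solve-∀
  regroup : ∀ X B Y → X * (B * Y) ≡ X * Y * B
  regroup = ℕRing.solve-∀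

-- Enumerating candidate generating families

length-cartesianProductWith : ∀ {A B C : Set} (f : A → B → C) xs ys →
                              length (cartesianProductWith f xs ys) ≡ length xs * length ys
length-cartesianProductWith f []       ys = refl
length-cartesianProductWith f (x ∷ xs) ys =
  trans (ListP.length-++ (map (f x) ys)) (cong₂ _+_ (ListP.length-map (f x) ys) (length-cartesianProductWith f xs ys))

units : ∀ {k} → List (ℤ^ k)
units {zero}  = 0v ∷ []
units {suc k} = (1ℤ ∷ᵛ 0v) ∷ (-1ℤ ∷ᵛ 0v) ∷ map (0ℤ ∷ᵛ_) units

length-units : ∀ k → length (units {k}) ≡ suc (k + k)
length-units zero    = refl
length-units (suc k) = cong (λ x → suc (suc x)) (trans (ListP.length-map (0ℤ ∷ᵛ_) (units {k}))
                                                       (trans (length-units k) (sym (ℕP.+-suc k k))))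

units-norm : ∀ {k} {s : ℤ^ k} → s ∈ units → norm1 s ≤ 1
units-norm {zero}  (here refl)         = z≤n
units-norm {suc k} (here refl)         = s≤s (ℕP.≤-reflexive (norm1-0v {k}))
units-norm {suc k} (there (here refl)) = s≤s (ℕP.≤-reflexive (norm1-0v {k}))
units-norm {suc k} (there (there s∈)) with ∈-map⁻ (0ℤ ∷ᵛ_) s∈
... | s′ , s′∈ , refl = units-norm s′∈

peel : ∀ {k N} (v : ℤ^ k) → norm1 v ≤ suc N → ∃ λ s → s ∈ units × ∃ λ w → v ≈ s +v w × norm1 w ≤ N
peel {zero} v _ = 0v , here refl , v , (λ ()) , z≤n
peel {suc k} v ‖v‖≤ with v zero in v₀≡
... | + zero with peel (tail v) ‖v‖≤
...   | s , s∈ , w , v≈ , ‖w‖≤ =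
  0ℤ ∷ᵛ s , there (there (∈-map⁺ (0ℤ ∷ᵛ_) s∈)) , 0ℤ ∷ᵛ w , (λ { zero → v₀≡ ; (suc i) → v≈ i }) , ‖w‖≤
peel {suc k} v ‖v‖≤ | + suc x =
  1ℤ ∷ᵛ 0v , here refl , + x ∷ᵛ tail v ,
  (λ { zero → v₀≡ ; (suc i) → sym (ℤP.+-identityˡ (v (suc i))) }) , ℕP.≤-pred ‖v‖≤
peel {suc k} {N} v ‖v‖≤ | -[1+ x ] =
  -1ℤ ∷ᵛ 0v , there (here refl) , ℤ.- + x ∷ᵛ tail v ,
  (λ { zero → trans v₀≡ (-[1+x]≡-1-x (+ x)) ; (suc i) → sym (ℤP.+-identityˡ (v (suc i))) }) ,
  subst (_≤ N) (cong (_+ norm1 (tail v)) (sym (ℤP.∣-i∣≡∣i∣ (+ x)))) (ℕP.≤-pred ‖v‖≤)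
  where -[1+x]≡-1-x : ∀ x → ℤ.- (1ℤ ℤ.+ x) ≡ -1ℤ ℤ.+ ℤ.- x
        -[1+x]≡-1-x = ℤRing.solve-∀

short : ∀ {k} → ℕ → List (ℤ^ k)
short zero    = 0v ∷ []
short (suc N) = cartesianProductWith _+v_ units (short N)

length-short : ∀ k N → length (short {k} N) ≡ suc (k + k) ^ N
length-short k zero    = refl
length-short k (suc N) =
  trans (length-cartesianProductWith _+v_ (units {k}) (short N)) (cong₂ _*_ (length-units k) (length-short k N))

short-norm : ∀ {k} N {u : ℤ^ k} → u ∈ short N → norm1 u ≤ N
short-norm {k} zero (here refl) = ℕP.≤-reflexive (norm1-0v {k})
short-norm (suc N) u∈ with ∈-cartesianProductWith⁻ _+v_ units (short N) u∈
... | s , u , s∈ , u∈′ , refl = ℕP.≤-trans (norm1-+ s u) (ℕP.+-mono-≤ (units-norm s∈) (short-norm N u∈′))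

short-complete : ∀ {k} N (v : ℤ^ k) → norm1 v ≤ N → ∃ λ u → u ∈ short N × u ≈ v
short-complete zero    v ‖v‖≤0 =
  0v , here refl , λ i → sym (ℤP.∣i∣≡0⇒i≡0 (ℕP.n≤0⇒n≡0 (ℕP.≤-trans (∣coord∣≤norm1 v i) ‖v‖≤0)))
short-complete (suc N) v ‖v‖≤ with peel v ‖v‖≤
... | s , s∈ , w , v≈ , ‖w‖≤ with short-complete N w ‖w‖≤
...   | u , u∈ , u≈ =
  s +v u , ∈-cartesianProductWith⁺ _+v_ s∈ u∈ , λ i → trans (cong (ℤ._+_ (s i)) (u≈ i)) (sym (v≈ i))

tuples : ∀ {k} → ℕ → ℕ → List (List (ℤ^ k))
tuples N zero    = [] ∷ []
tuples N (suc R) = cartesianProductWith _∷_ (short N) (tuples N R)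

length-tuples : ∀ k N R → length (tuples {k} N R) ≡ (suc (k + k) ^ N) ^ R
length-tuples k N zero    = refl
length-tuples k N (suc R) =
  trans (length-cartesianProductWith _∷_ (short {k} N) (tuples N R)) (cong₂ _*_ (length-short k N) (length-tuples k N R))

tuples-sound : ∀ {k} N R {l : List (ℤ^ k)} → l ∈ tuples N R → (∀ {x} → x ∈ l → x ∈ short N) × length l ≡ R
tuples-sound N zero    (here refl) = (λ ()) , refl
tuples-sound N (suc R) l∈ with ∈-cartesianProductWith⁻ _∷_ (short N) (tuples N R) l∈
... | x , l , x∈ , l∈′ , refl with tuples-sound N R l∈′
...   | l⊆ , length-l = (λ { (here refl) → x∈ ; (there y∈) → l⊆ y∈ }) , cong suc length-l

tuples-complete : ∀ {k} N (l : List (ℤ^ k)) → (∀ {x} → x ∈ l → norm1 x ≤ N) →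
                  ∃ λ l′ → l′ ∈ tuples N (length l) × Pointwise _≈_ l′ l
tuples-complete N []      _     = [] , here refl , []
tuples-complete N (x ∷ l) short-l
  with short-complete N x (short-l (here refl)) | tuples-complete N l (λ y∈ → short-l (there y∈))
... | u , u∈ , u≈x | l′ , l′∈ , l′≈l = u ∷ l′ , ∈-cartesianProductWith⁺ _∷_ u∈ l′∈ , u≈x ∷ l′≈l

pad : ∀ {k} → ℕ → List (ℤ^ k) → List (ℤ^ k)
pad R S = S ++ replicate (R ∸ length S) 0v

length-pad : ∀ {k} R (S : List (ℤ^ k)) → length S ≤ R → length (pad R S) ≡ R
length-pad R S |S|≤R = trans (ListP.length-++ S) (trans (cong (_+_ (length S)) (ListP.length-replicate (R ∸ length S)))
                                                        (ℕP.m+[n∸m]≡n |S|≤R))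

∈-pad⁻ : ∀ {k} R (S : List (ℤ^ k)) {y} → y ∈ pad R S → y ∈ S ⊎ y ≡ 0v
∈-pad⁻ R S y∈ with ∈-++⁻ S y∈
... | inj₁ y∈S = inj₁ y∈S
... | inj₂ y∈0 = inj₂ (All.lookup (AllP.replicate⁺ {P = _≡ 0v} (R ∸ length S) refl) y∈0)

pad-short : ∀ {k N} R (S : List (ℤ^ k)) → (∀ {x} → x ∈ S → norm1 x ≤ N) →
            ∀ {y} → y ∈ pad R S → norm1 y ≤ N
pad-short {k} R S S-short y∈ with ∈-pad⁻ R S y∈
... | inj₁ y∈S = S-short y∈S
... | inj₂ refl = subst (_≤ _) (sym (norm1-0v {k})) z≤n

pad-∼ : ∀ {k} R (S : List (ℤ^ k)) → S ∼ pad R S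
pad-∼ R S = zeros-∼ ∈-++⁺ˡ (∈-pad⁻ R S)

toGens : ∀ {k} m → List (ℤ^ k) → Gens k m
toGens (suc m) []      zero    = 0v
toGens (suc m) []      (suc t) = toGens m [] t
toGens (suc m) (x ∷ l) zero    = x
toGens (suc m) (x ∷ l) (suc t) = toGens m l t

tabulate-toGens : ∀ {k} m (l : List (ℤ^ k)) → length l ≤ m → tabulate (toGens m l) ≡ pad m l
tabulate-toGens zero    []      _         = refl
tabulate-toGens (suc m) []      _         = cong (0v ∷_) (tabulate-toGens m [] z≤n)
tabulate-toGens (suc m) (x ∷ l) (s≤s |l|≤m) = cong (x ∷_) (tabulate-toGens m l |l|≤m)

candidates : ∀ {k} m N R → List (Gens k m)
candidates m N R = map (toGens m) (tuples N R)

length-candidates : ∀ k m N R → length (candidates {k} m N R) ≡ (suc (k + k) ^ N) ^ R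
length-candidates k m N R = trans (ListP.length-map (toGens m) (tuples N R)) (length-tuples k N R)

candidates-short : ∀ {k m} N R → R ≤ m → ∀ {gs} → gs ∈ candidates {k} m N R → ∀ t → norm1 (gs t) ≤ N
candidates-short {k} {m} N R R≤m gs∈ t with ∈-map⁻ (toGens m) gs∈
... | l , l∈ , refl with tuples-sound N R l∈
...   | l⊆short , length-l =
  pad-short m l (λ x∈l → short-norm N (l⊆short x∈l))
            (subst (toGens m l t ∈_) (tabulate-toGens m l (subst (_≤ m) (sym length-l) R≤m)) (∈-tabulate⁺ t))

candidates-cover : ∀ {k m} N R → (∀ {S : List (ℤ^ k)} → ShortChain N S → length S ≤ R) →
                   (fs : Gens k m) → (∀ t → norm1 (fs t) ≤ N) → Any (SameSpan fs) (candidates m N (R ⊓ m))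
candidates-cover {k} {m} N R chain-short fs fs-short =
  lose (∈-map⁺ (toGens m) l∈) (tabulate-∼⇒SameSpan fs (toGens m l) fs∼l)
  where
  xs-short : ∀ {x} → x ∈ tabulate fs → norm1 x ≤ N
  xs-short x∈ with ∈-tabulate⁻ x∈
  ... | t , refl = fs-short t
  open Greedy (greedy N (tabulate fs) xs-short)
  R′ = R ⊓ m
  |basis|≤R′ : length basis ≤ R′
  |basis|≤R′ = ℕP.⊓-glb (chain-short chain)
                        (ℕP.≤-trans (length-mono-≤ basis⊆xs) (ℕP.≤-reflexive (ListP.length-tabulate fs)))
  completion = tuples-complete N (pad R′ basis) (pad-short R′ basis (λ x∈ → xs-short (Any-resp-⊆ basis⊆xs x∈)))
  l = proj₁ completion
  l∈ : l ∈ tuples N R′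
  l∈ = subst (λ r → l ∈ tuples N r) (length-pad R′ basis |basis|≤R′) (proj₁ (proj₂ completion))
  fs∼l : tabulate fs ∼ tabulate (toGens m l)
  fs∼l = ∼-trans (∼-sym basis∼xs)
         (∼-trans (pad-∼ R′ basis)
         (∼-trans (∼-sym (Pointwise⇒∼ (proj₂ (proj₂ completion))))
                  (subst (l ∼_) (sym (tabulate-toGens m l |l|≤m)) (pad-∼ m l))))
    where
    |l|≤m : length l ≤ m
    |l|≤m = subst (_≤ m) (sym (proj₂ (tuples-sound N R′ l∈))) (ℕP.m⊓n≤n R m)

D≤2^[1+⌊log₂D⌋] : ∀ D → D ≤ 2 ^ suc ⌊log₂ D ⌋
D≤2^[1+⌊log₂D⌋] D with D ℕ.≤? 2 ^ suc ⌊log₂ D ⌋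
... | yes D≤ = D≤
... | no  D≰ = ⊥-elim (ℕP.<⇒≱ (ℕP.n<1+n ⌊log₂ D ⌋)
                (subst (_≤ ⌊log₂ D ⌋) (⌊log₂[2^n]⌋≡n (suc ⌊log₂ D ⌋)) (⌊log₂⌋-mono-≤ (ℕP.<⇒≤ (ℕP.≰⇒> D≰)))))

1≤⌊log₂D⌋ : ∀ {D} → 2 ≤ D → 1 ≤ ⌊log₂ D ⌋
1≤⌊log₂D⌋ {D} 2≤D = subst (_≤ ⌊log₂ D ⌋) (⌊log₂[2^n]⌋≡n 1) (⌊log₂⌋-mono-≤ 2≤D)

1+2k≤k³ : ∀ {k} → 2 ≤ k → suc (k + k) ≤ k ^ 3
1+2k≤k³ {suc zero} (s≤s ())
1+2k≤k³ {suc (suc j)} _ = ℕP.≤-trans (ℕP.m≤m+n _ _) (ℕP.≤-reflexive (expand j))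
  where
  expand : ∀ j → suc ((2 + j) + (2 + j)) + (j * j * j + 6 * j * j + 10 * j + 3) ≡ (2 + j) * ((2 + j) * ((2 + j) * 1))
  expand = ℕRing.solve-∀

[5+ℓ]k+[5+ℓ]k+1≤13ℓk : ∀ {ℓ k} → 1 ≤ ℓ → 1 ≤ k → (5 + ℓ) * k + (5 + ℓ) * k + 1 ≤ 13 * ℓ * k
[5+ℓ]k+[5+ℓ]k+1≤13ℓk {suc ℓ′} {suc k′} _ _ =
  ℕP.≤-trans (ℕP.m≤m+n _ (11 * ℓ′ * suc k′ + k′)) (ℕP.≤-reflexive (expand ℓ′ k′))
  where
  expand : ∀ ℓ′ k′ → (6 + ℓ′) * suc k′ + (6 + ℓ′) * suc k′ + 1 + (11 * ℓ′ * suc k′ + k′) ≡ 13 * suc ℓ′ * suc k′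
  expand = ℕRing.solve-∀

4[3D-1]≤2^[5+⌊log₂D⌋] : ∀ D → 4 * ℕ.pred (3 * D) ≤ 2 ^ (5 + ⌊log₂ D ⌋)
4[3D-1]≤2^[5+⌊log₂D⌋] D = begin
  4 * ℕ.pred (3 * D)          ≤⟨ ℕP.*-monoʳ-≤ 4 (ℕP.pred[n]≤n {3 * D}) ⟩
  4 * (3 * D)                 ≤⟨ ℕP.≤-trans (ℕP.≤-reflexive (regroup D)) (ℕP.m≤m+n (12 * D) (4 * D)) ⟩
  12 * D + 4 * D              ≡⟨ regroup′ D ⟩
  16 * D                      ≤⟨ ℕP.*-monoʳ-≤ 16 (D≤2^[1+⌊log₂D⌋] D) ⟩
  2 ^ 4 * 2 ^ suc ⌊log₂ D ⌋   ≡⟨ ℕP.^-distribˡ-+-* 2 4 (suc ⌊log₂ D ⌋) ⟨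
  2 ^ (5 + ⌊log₂ D ⌋)         ∎
  where
  open ℕP.≤-Reasoning
  regroup : ∀ D → 4 * (3 * D) ≡ 12 * D
  regroup = ℕRing.solve-∀
  regroup′ : ∀ D → 12 * D + 4 * D ≡ 16 * D
  regroup′ = ℕRing.solve-∀

-- The bound on the length of a short chain for L = 5 + ⌊log₂ D⌋, so that 4 (3D - 1) ≤ 2^L.
rank : ℕ → ℕ → ℕ
rank k D = (5 + ⌊log₂ D ⌋) * k + (5 + ⌊log₂ D ⌋) * k + 1

candidate-count : ∀ {k D} m → 2 ≤ k → 2 ≤ D →
                  (suc (k + k) ^ ℕ.pred (3 * D)) ^ (rank k D ⊓ m) ≤ k ^ (117 * k * D * ⌊log₂ D ⌋)
candidate-count {k} {D} m 2≤k 2≤D = begin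
  (suc (k + k) ^ n′) ^ R′  ≡⟨ ℕP.^-*-assoc (suc (k + k)) n′ R′ ⟩
  suc (k + k) ^ (n′ * R′)  ≤⟨ ℕP.^-monoˡ-≤ (n′ * R′) (1+2k≤k³ 2≤k) ⟩
  (k ^ 3) ^ (n′ * R′)      ≡⟨ ℕP.^-*-assoc k 3 (n′ * R′) ⟩
  k ^ (3 * (n′ * R′))      ≤⟨ ℕP.^-monoʳ-≤ k {{ℕ.>-nonZero (ℕP.≤-trans (s≤s z≤n) 2≤k)}} exponent ⟩
  k ^ (117 * k * D * ℓ)    ∎
  where
  open ℕP.≤-Reasoning
  ℓ = ⌊log₂ D ⌋
  n′ = ℕ.pred (3 * D)
  R′ = rank k D ⊓ m
  exponent : 3 * (n′ * R′) ≤ 117 * k * D * ℓ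
  exponent = ℕP.≤-trans (ℕP.*-monoʳ-≤ 3 (ℕP.*-mono-≤ (ℕP.pred[n]≤n {3 * D})
                          (ℕP.≤-trans (ℕP.m⊓n≤m (rank k D) m)
                             ([5+ℓ]k+[5+ℓ]k+1≤13ℓk (1≤⌊log₂D⌋ 2≤D) (ℕP.≤-trans (s≤s z≤n) 2≤k)))))
                        (ℕP.≤-reflexive (regroup D ℓ k))
    where
    regroup : ∀ D ℓ k → 3 * (3 * D * (13 * ℓ * k)) ≡ 117 * k * D * ℓ
    regroup = ℕRing.solve-∀

claim3p3 : Σ ℕ λ C → 0 < C × ((k D m : ℕ) → 2 ≤ k → 2 ≤ D → 2 ≤ m →
             Σ (List (Gens k m)) λ L →
               length L ≤ k ^ (C * k * D * ⌊log₂ D ⌋)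
               × All (Bounded D) L
               × ((fs : Gens k m) → Bounded D fs → Any (SameSpan fs) L))
claim3p3 = 117 , s≤s z≤n , family
  where
  family : (k D m : ℕ) → 2 ≤ k → 2 ≤ D → 2 ≤ m →
           Σ (List (Gens k m)) λ L → length L ≤ k ^ (117 * k * D * ⌊log₂ D ⌋) × All (Bounded D) L
                                    × ((fs : Gens k m) → Bounded D fs → Any (SameSpan fs) L)
  family k D m 2≤k 2≤D _ =
    candidates m n′ R′ ,
    ℕP.≤-trans (ℕP.≤-reflexive (length-candidates k m n′ R′)) (candidate-count m 2≤k 2≤D) ,
    All.tabulate (λ gs∈ t → ℕP.≤-trans (s≤s (candidates-short n′ R′ (ℕP.m⊓n≤n (rank k D) m) gs∈ t)) 1+n′≤3D) ,
    λ fs fs-bounded → candidates-cover n′ (rank k D) chain-length fs (λ t → ℕP.<⇒≤pred (fs-bounded t))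
    where
    n′ = ℕ.pred (3 * D)
    R′ = rank k D ⊓ m
    1+n′≤3D : suc n′ ≤ 3 * D
    1+n′≤3D = ℕP.≤-reflexive (ℕP.suc-pred (3 * D) {{ℕ.>-nonZero (ℕP.≤-trans (s≤s z≤n) (ℕP.*-monoʳ-≤ 3 2≤D))}})
    chain-length : ∀ {S : List (ℤ^ k)} → ShortChain n′ S → length S ≤ rank k D
    chain-length chain = short-chain-length {L = 5 + ⌊log₂ D ⌋} 1≤n′ chain (4[3D-1]≤2^[5+⌊log₂D⌋] D)
      where 1≤n′ = ℕP.pred-mono-≤ (ℕP.≤-trans (s≤s (s≤s z≤n)) (ℕP.*-monoʳ-≤ 3 2≤D))
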